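{- Let $F=F_1\vee\dots\vee F_m$ be a formula on variable set $V=[n]$ and let $\tilde\rho\colon T_F\to\{0,1,*\}^V$ be a restriction tree for $F$. Let $s$ be a positive integer, $a\in\{0,1\}^s$, and let $\alpha$ be an ordered restriction with $\mathrm{CDT}^{(a)}_0(F,\tilde\rho)=\alpha$. Suppose $\tilde\rho'\colon T_F\to\{0,1,*\}^V$ is another restriction tree for $F$ such that $\tilde\rho'\preccurlyeq\tilde\rho$ and $\tilde\rho'(G)|_{\mathrm{Dom}(\alpha)}=\tilde\rho(G)|_{\mathrm{Dom}(\alpha)}$ for all $G\in T_F$. Then $\mathrm{CDT}^{(a)}_0(F,\tilde\rho')=\alpha$. Similarly, if $F=F_1\wedge\dots\wedge F_m$, the same holds with $\mathrm{CDT}^{(a)}_0$ replaced by $\mathrm{CDT}^{(a)}_1$.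
   Context: Formulas: a depth-0 formula is $0$, $1$, $x_v$ or $\neg x_v$; for $d\ge1$ a depth-$d$ OR-formula is $F_1\vee\dots\vee F_m$ with each $F_i$ a depth-0 formula or an AND-formula of depth $d'$, $1\le d'<d$; AND-formulas dually. $T_F$ is the set of subformulas of $F$ (nodes of its formula tree, including $F$). Restrictions $\rho\colon V\to\{0,1,*\}$, $\mathrm{Dom}(\rho)=\rho^{ -1}(\{0,1\})$, $\mathrm{stars}(\rho)=\rho^{ -1}(*)$; $\rho_1,\rho_2$ consistent if they agree on $\mathrm{Dom}(\rho_1)\cap\mathrm{Dom}(\rho_2)$; $\rho_1\preccurlyeq\rho_2$ iff $\mathrm{stars}(\rho_1)\subseteq\mathrm{stars}(\rho_2)$ and they are consistent. $G|_\rho$: replace literals of variables in $\mathrm{Dom}(\rho)$ by their values, no simplification (same formula tree); $G|_\rho\equiv c$ means it computes the constant function $c$. Ordered restriction: sequence $(x_{v_1}\to b_1,\dots,x_{v_t}\to b_t)$ of distinct variables, also viewed as a restriction. A restriction tree for $F$ is a map $\tilde\rho\colon T_F\to\{0,1,*\}^V$ with $\tilde\rho(H)\preccurlyeq\tilde\rho(G)$ whenever $G$ is a subformula of $H$; $\tilde\rho|_G$ is its restriction to $T_G$; for restriction trees, $\tilde\rho'\preccurlyeq\tilde\rho$ iff $\tilde\rho'(G)\preccurlyeq\tilde\rho(G)$ for all $G\in T_F$. For a restriction $\alpha$ on variables, $F|_\alpha$ has the same formula tree as $F$, so $\tilde\rho$ is also a restriction tree for $F|_\alpha$. Decision trees: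 internal nodes labelled by variables with one or two children, child edges carrying distinct labels in $\{0,1\}$, leaves labelled $0/1$, distinct variables on each path; $\alpha_v$ is the ordered restriction read along the root-to-$v$ path. Applying a restriction $\rho$ to a decision tree: delete every subtree hanging from an edge whose label disagrees with $\rho$ on the variable queried at its parent. 0-balancing of a decision tree $\Gamma$: first contract every subtree all of whose leaves are labelled 0 to a single 0-leaf; let $D$ be the longest root-to-leaf path length; for $i=1,\dots,D$, each 0-leaf $u$ (of the contracted tree) at distance $D-i$ from the root is replaced by a copy of the current subtree rooted at the sibling of $u$, with all leaves of the copy relabelled 0. 1-balancing is the same with the roles of 0 and 1 swapped. Canonical decision tree $\mathrm{CDT}(F,\tilde\rho)$, defined by induction on depth and number of variables: (1) if $F$ is a constant, a single leaf with that constant. (2) If $F$ is a literal on $x$: if $x\in\mathrm{Dom}(\tilde\rho(F))$, a single leaf with the literal's value; otherwise a root querying $x$ with two leaf children labelled by the literal's value. (3) If $F=F_1\vee\dots\vee F_m$: if $F_i|_{\tilde\rho(F)}\equiv0$ for all $i$, a single 0-leaf; otherwise let $\ell$ be least with $F_\ell|_{\tilde\rho(F)}\not\equiv 0$; if $F_\ell|_{\tilde\rho(F)}\equiv1$, a single 1-leaf; otherwise let $\Gamma=\mathrm{CDT}(F_\ell,\tilde\rho|_{F_\ell})$, let $\Gamma'$ be obtained by applying $\tilde\rho(F)$ to $\Gamma$, let $\Gamma''$ be the 0-balancing of $\Gamma'$, and replace each 0-leaf $u$ of $\Gamma''$ by $\mathrm{CDT}(F|_{\alpha_u},\tilde\rho)$.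 For $F=F_1\wedge\dots\wedge F_m$ the same with 0 and 1 swapped (using 1-balancing). For $a\in\{0,1\}^s$ and $b\in\{0,1\}$: $\mathrm{CDT}^{(a)}_b(F,\tilde\rho)=\alpha_w$ if there is a leaf $w$ labelled $b$ reached by walking from the root, following the unique edge at degree-1 nodes and taking the edge labelled $a_i$ at the $i$-th degree-2 node, with exactly $s$ degree-2 nodes on the path; otherwise it is undefined ($\bot$). -}

module Defs where

open import Data.Nat using (ℕ; zero; suc; _<_; _⊔_)
open import Data.Fin using (Fin; toℕ; _≟_)
open import Data.Bool using (Bool; true; false; _∧_; not; if_then_else_)
open import Data.Bool.Properties using () renaming (_≟_ to _≟B_)
open import Data.Maybe using (Maybe; just; nothing)
open import Data.List using (List; []; _∷_; _++_; _∷ʳ_; length; lookup; map)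
open import Data.List.Relation.Unary.All using (All)
open import Data.List.Membership.Propositional using (_∈_)
open import Data.Product using (_×_; _,_; proj₁)
open import Data.Unit using (⊤)
open import Data.Empty using (⊥)
open import Relation.Nullary using (¬_; yes; no; does)
open import Relation.Binary.PropositionalEquality using (_≡_; _≢_)

data Formula (n : ℕ) : Set where
  const : Bool → Formula n
  -- lit true v  is the literal x_v,  lit false v  is the literal ¬x_v
  lit   : Bool → Fin n → Formula n
  or    : List (Formula n) → Formula n
  and   : List (Formula n) → Formula n

gate : ∀ {n} → Bool → List (Formula n) → Formula n
gate false Fs = or Fs
gate true  Fs = and Fs

NotOr : ∀ {n} → Formula n → Set
NotOr (or _) = ⊥
NotOr _      = ⊤

NotAnd : ∀ {n} → Formula n → Set
NotAnd (and _) = ⊥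
NotAnd _       = ⊤

-- well-formedness (depth alternation): children of an OR are depth-0
-- formulas or AND-formulas, children of an AND are depth-0 or OR-formulas
data WF {n : ℕ} : Formula n → Set where
  wf-const : ∀ c → WF (const c)
  wf-lit   : ∀ p v → WF (lit p v)
  wf-or    : ∀ {Fs} → All (λ G → NotOr G × WF G) Fs → WF (or Fs)
  wf-and   : ∀ {Fs} → All (λ G → NotAnd G × WF G) Fs → WF (and Fs)

litVal : Bool → Bool → Bool
litVal true  b = b
litVal false b = not b

mutual
  eval : ∀ {n} → Formula n → (Fin n → Bool) → Bool
  eval (const c) x = c
  eval (lit p v) x = litVal p (x v)
  eval (or Fs)   x = evalOr Fs x
  eval (and Fs)  x = evalAnd Fs x

  evalOr : ∀ {n} → List (Formula n) → (Fin n → Bool) → Bool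
  evalOr []       x = false
  evalOr (F ∷ Fs) x = if eval F x then true else evalOr Fs x

  evalAnd : ∀ {n} → List (Formula n) → (Fin n → Bool) → Bool
  evalAnd []       x = true
  evalAnd (F ∷ Fs) x = if eval F x then evalAnd Fs x else false

-- Restrictions  ρ : V → {0,1,*}   (nothing = *)

Restriction : ℕ → Set
Restriction n = Fin n → Maybe Bool

Consistent : ∀ {n} → Restriction n → Restriction n → Set
Consistent ρ₁ ρ₂ = ∀ v b c → ρ₁ v ≡ just b → ρ₂ v ≡ just c → b ≡ c

_≼_ : ∀ {n} → Restriction n → Restriction n → Set
ρ₁ ≼ ρ₂ = (∀ v → ρ₁ v ≡ nothing → ρ₂ v ≡ nothing) × Consistent ρ₁ ρ₂

-- G|ρ : replace literals of variables in Dom(ρ) by their values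
-- (same formula tree, no simplification)
mutual
  restrictF : ∀ {n} → Formula n → Restriction n → Formula n
  restrictF (const c) ρ = const c
  restrictF (lit p v) ρ with ρ v
  ... | just b  = const (litVal p b)
  ... | nothing = lit p v
  restrictF (or Fs)  ρ = or (restrictFs Fs ρ)
  restrictF (and Fs) ρ = and (restrictFs Fs ρ)

  restrictFs : ∀ {n} → List (Formula n) → Restriction n → List (Formula n)
  restrictFs []       ρ = []
  restrictFs (F ∷ Fs) ρ = restrictF F ρ ∷ restrictFs Fs ρ

ComputesConst : ∀ {n} → Formula n → Bool → Set
ComputesConst {n} G c = ∀ (x : Fin n → Bool) → eval G x ≡ c

RestrictsTo : ∀ {n} → Formula n → Restriction n → Bool → Set
RestrictsTo G ρ c = ComputesConst (restrictF G ρ) c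

OrdRestr : ℕ → Set
OrdRestr n = List (Fin n × Bool)

toRestr : ∀ {n} → OrdRestr n → Restriction n
toRestr []             v = nothing
toRestr ((x , b) ∷ α)  v with does (x ≟ v)
... | true  = just b
... | false = toRestr α v

_∈Dom_ : ∀ {n} → Fin n → OrdRestr n → Set
v ∈Dom α = v ∈ map proj₁ α

-- Formula tree nodes T_F : positions (paths of child indices)

data ValidPos {n : ℕ} : Formula n → List ℕ → Set where
  here  : ∀ {F} → ValidPos F []
  inOr  : ∀ {Fs p} (i : Fin (length Fs)) →
          ValidPos (lookup Fs i) p → ValidPos (or Fs) (toℕ i ∷ p)
  inAnd : ∀ {Fs p} (i : Fin (length Fs)) →
          ValidPos (lookup Fs i) p → ValidPos (and Fs) (toℕ i ∷ p)

-- a restriction tree assigns a restriction to every node of T_F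
-- (values at non-nodes are irrelevant)
RTree : ℕ → Set
RTree n = List ℕ → Restriction n

IsRestrTree : ∀ {n} → Formula n → RTree n → Set
IsRestrTree F ρ̃ = ∀ p q → ValidPos F (p ++ q) → ρ̃ p ≼ ρ̃ (p ++ q)

_≼T_within_ : ∀ {n} → RTree n → RTree n → Formula n → Set
ρ̃' ≼T ρ̃ within F = ∀ p → ValidPos F p → ρ̃' p ≼ ρ̃ p

childRT : ∀ {n} → RTree n → ℕ → RTree n
childRT ρ̃ i p = ρ̃ (i ∷ p)

-- Decision trees.  node x t₀ t₁ queries x; t₀ (resp. t₁) is the child
-- along the edge labelled 0 (resp. 1), nothing if that edge is absent.

data DT (n : ℕ) : Set where
  leaf : Bool → DT n
  node : Fin n → Maybe (DT n) → Maybe (DT n) → DT n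

mutual
  applyR : ∀ {n} → Restriction n → DT n → DT n
  applyR ρ (leaf c) = leaf c
  applyR ρ (node x m₀ m₁) with ρ x
  ... | just false = node x (applyRM ρ m₀) nothing
  ... | just true  = node x nothing (applyRM ρ m₁)
  ... | nothing    = node x (applyRM ρ m₀) (applyRM ρ m₁)

  applyRM : ∀ {n} → Restriction n → Maybe (DT n) → Maybe (DT n)
  applyRM ρ nothing  = nothing
  applyRM ρ (just t) = just (applyR ρ t)

mutual
  allLeaves : ∀ {n} → Bool → DT n → Bool
  allLeaves b (leaf c)       = does (c ≟B b)
  allLeaves b (node x m₀ m₁) = allLeavesM b m₀ ∧ allLeavesM b m₁

  allLeavesM : ∀ {n} → Bool → Maybe (DT n) → Bool
  allLeavesM b nothing  = true
  allLeavesM b (just t) = allLeaves b t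

mutual
  contract : ∀ {n} → Bool → DT n → DT n
  contract b (leaf c) = leaf c
  contract b (node x m₀ m₁) =
    let t = node x (contractM b m₀) (contractM b m₁) in
    if allLeaves b t then leaf b else t

  contractM : ∀ {n} → Bool → Maybe (DT n) → Maybe (DT n)
  contractM b nothing  = nothing
  contractM b (just t) = just (contract b t)

mutual
  relabel : ∀ {n} → Bool → DT n → DT n
  relabel b (leaf c)       = leaf b
  relabel b (node x m₀ m₁) = node x (relabelM b m₀) (relabelM b m₁)

  relabelM : ∀ {n} → Bool → Maybe (DT n) → Maybe (DT n)
  relabelM b nothing  = nothing
  relabelM b (just t) = just (relabel b t)

mutual
  height : ∀ {n} → DT n → ℕ
  height (leaf c)       = 0
  height (node x m₀ m₁) = suc (heightM m₀ ⊔ heightM m₁)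

  heightM : ∀ {n} → Maybe (DT n) → ℕ
  heightM nothing  = 0
  heightM (just t) = height t

isLeaf : ∀ {n} → Bool → DT n → Bool
isLeaf b (leaf c)       = does (c ≟B b)
isLeaf b (node x m₀ m₁) = false

-- simultaneously replace every b-leaf at distance k from the root by a
-- copy of (the current subtree at) its sibling with leaves relabelled b
mutual
  replaceAt : ∀ {n} → Bool → ℕ → DT n → DT n
  replaceAt b zero t = t
  replaceAt b (suc zero) (node x (just l) (just r)) =
    node x (just (if isLeaf b l then relabel b r else l))
           (just (if isLeaf b r then relabel b l else r))
  replaceAt b (suc zero) t = t
  replaceAt b (suc (suc k)) (leaf c) = leaf c
  replaceAt b (suc (suc k)) (node x m₀ m₁) =
    node x (replaceAtM b (suc k) m₀) (replaceAtM b (suc k) m₁)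

  replaceAtM : ∀ {n} → Bool → ℕ → Maybe (DT n) → Maybe (DT n)
  replaceAtM b k nothing  = nothing
  replaceAtM b k (just t) = just (replaceAt b k t)

-- steps i = 1 … D : replace b-leaves at distance D - i
-- (balanceSteps b j t performs the steps at distances j-1, j-2, …, 0)
balanceSteps : ∀ {n} → Bool → ℕ → DT n → DT n
balanceSteps b zero    t = t
balanceSteps b (suc j) t = balanceSteps b j (replaceAt b j t)

balance : ∀ {n} → Bool → DT n → DT n
balance b Γ = balanceSteps b (height (contract b Γ)) (contract b Γ)

-- replace each b-leaf u of a tree by a tree t with R α_u t
-- (α is the ordered restriction read along the path so far)
mutual
  data Graft {n : ℕ} (R : OrdRestr n → DT n → Set) (b : Bool)
             : OrdRestr n → DT n → DT n → Set where
    g-leafb : ∀ {α t} → R α t → Graft R b α (leaf b) t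
    g-leafo : ∀ {α c} → c ≢ b → Graft R b α (leaf c) (leaf c)
    g-node  : ∀ {α x m₀ m₁ m₀' m₁'} →
              GraftM R b (α ∷ʳ (x , false)) m₀ m₀' →
              GraftM R b (α ∷ʳ (x , true)) m₁ m₁' →
              Graft R b α (node x m₀ m₁) (node x m₀' m₁')

  data GraftM {n : ℕ} (R : OrdRestr n → DT n → Set) (b : Bool)
              : OrdRestr n → Maybe (DT n) → Maybe (DT n) → Set where
    g-nothing : ∀ {α} → GraftM R b α nothing nothing
    g-just    : ∀ {α t t'} → Graft R b α t t' → GraftM R b α (just t) (just t')

-- Canonical decision tree, as the (inductively defined) relation
-- IsCDT F ρ̃ Γ  meaning  Γ = CDT(F, ρ̃).

data IsCDT {n : ℕ} : Formula n → RTree n → DT n → Set where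
  cdt-const : ∀ {ρ̃} c → IsCDT (const c) ρ̃ (leaf c)
  cdt-lit-fixed : ∀ {ρ̃ p x b} → ρ̃ [] x ≡ just b →
                  IsCDT (lit p x) ρ̃ (leaf (litVal p b))
  cdt-lit-free  : ∀ {ρ̃ p x} → ρ̃ [] x ≡ nothing →
                  IsCDT (lit p x) ρ̃
                    (node x (just (leaf (litVal p false))) (just (leaf (litVal p true))))
  cdt-or-0 : ∀ {Fs ρ̃} →
             (∀ i → RestrictsTo (lookup Fs i) (ρ̃ []) false) →
             IsCDT (or Fs) ρ̃ (leaf false)
  cdt-or-1 : ∀ {Fs ρ̃} (ℓ : Fin (length Fs)) →
             (∀ i → toℕ i < toℕ ℓ → RestrictsTo (lookup Fs i) (ρ̃ []) false) →
             RestrictsTo (lookup Fs ℓ) (ρ̃ []) true →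
             IsCDT (or Fs) ρ̃ (leaf true)
  cdt-or-rec : ∀ {Fs ρ̃ Γ Γ'''} (ℓ : Fin (length Fs)) →
             (∀ i → toℕ i < toℕ ℓ → RestrictsTo (lookup Fs i) (ρ̃ []) false) →
             ¬ RestrictsTo (lookup Fs ℓ) (ρ̃ []) false →
             ¬ RestrictsTo (lookup Fs ℓ) (ρ̃ []) true →
             IsCDT (lookup Fs ℓ) (childRT ρ̃ (toℕ ℓ)) Γ →
             Graft (λ α t → IsCDT (restrictF (or Fs) (toRestr α)) ρ̃ t) false []
                   (balance false (applyR (ρ̃ []) Γ)) Γ''' →
             IsCDT (or Fs) ρ̃ Γ'''
  cdt-and-1 : ∀ {Fs ρ̃} →
             (∀ i → RestrictsTo (lookup Fs i) (ρ̃ []) true) →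
             IsCDT (and Fs) ρ̃ (leaf true)
  cdt-and-0 : ∀ {Fs ρ̃} (ℓ : Fin (length Fs)) →
             (∀ i → toℕ i < toℕ ℓ → RestrictsTo (lookup Fs i) (ρ̃ []) true) →
             RestrictsTo (lookup Fs ℓ) (ρ̃ []) false →
             IsCDT (and Fs) ρ̃ (leaf false)
  cdt-and-rec : ∀ {Fs ρ̃ Γ Γ'''} (ℓ : Fin (length Fs)) →
             (∀ i → toℕ i < toℕ ℓ → RestrictsTo (lookup Fs i) (ρ̃ []) true) →
             ¬ RestrictsTo (lookup Fs ℓ) (ρ̃ []) true →
             ¬ RestrictsTo (lookup Fs ℓ) (ρ̃ []) false →
             IsCDT (lookup Fs ℓ) (childRT ρ̃ (toℕ ℓ)) Γ →
             Graft (λ α t → IsCDT (restrictF (and Fs) (toRestr α)) ρ̃ t) true []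
                   (balance true (applyR (ρ̃ []) Γ)) Γ''' →
             IsCDT (and Fs) ρ̃ Γ'''

-- CDT^{(a)}_b : walk from the root, following the unique edge at degree-1
-- nodes and the edge a_i at the i-th degree-2 node; succeed with α_w iff
-- a b-leaf w is reached after exactly |a| degree-2 nodes.

mutual
  walk : ∀ {n} → Bool → DT n → List Bool → OrdRestr n → Maybe (OrdRestr n)
  walk b (leaf c) [] acc with does (c ≟B b)
  ... | true  = just acc
  ... | false = nothing
  walk b (leaf c) (_ ∷ _) acc = nothing
  walk b (node x nothing nothing) as acc = nothing
  walk b (node x (just l) nothing) as acc = walk b l as (acc ∷ʳ (x , false))
  walk b (node x nothing (just r)) as acc = walk b r as (acc ∷ʳ (x , true))
  walk b (node x (just l) (just r)) [] acc = nothing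
  walk b (node x (just l) (just r)) (false ∷ as) acc = walk b l as (acc ∷ʳ (x , false))
  walk b (node x (just l) (just r)) (true ∷ as) acc = walk b r as (acc ∷ʳ (x , true))

CDTpath : ∀ {n} → Bool → List Bool → DT n → Maybe (OrdRestr n)
CDTpath b a Γ = walk b Γ a []

-- A walk of CDT(F, ρ̃) ending in a b-leaf only queries variables of Dom(α), where ρ̃'
-- agrees with ρ̃; by induction along the construction of the CDT the same walk exists in
-- CDT(F, ρ̃').  As ρ̃' ≼ ρ̃ fixes more variables, the children of F that are constant b under
-- ρ̃ stay so, while the first non-constant child F_ℓ stays non-constant: the balanced tree
-- of F_ℓ has walks through Dom(α) to a b-leaf and to a non-b leaf, and these are followed
-- by inputs extending ρ̃'.  Hence both CDTs graft onto balanced trees for F_ℓ.  Balancing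
-- only depends on where the b-leaves and the non-b leaves are, and along walks through
-- Dom(α) the two unbalanced trees agree on both: on non-b leaves by induction (a walk
-- to a non-b leaf of a child of the opposite gate), on b-regions because both trees
-- compute F_ℓ.  The rest of the walk runs in CDTs of restrictions of F, again by induction.

module Submission where

open import Defs
open import Data.Bool using (Bool; true; false; _∧_; not; if_then_else_)
open import Data.Bool.Properties using (not-¬; ¬-not; ∧-identityʳ) renaming (_≟_ to _≟B_)
open import Data.Empty using (⊥-elim)
open import Data.Fin using (Fin; toℕ; _≟_) renaming (zero to fzero; suc to fsuc)
open import Data.Fin.Properties using (toℕ-injective)
open import Data.List using (List; []; _∷_; _++_; _∷ʳ_; map; length; lookup)
open import Data.List.Membership.Propositional using (lose)
open import Data.List.Membership.Propositional.Properties using (∈-lookup)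
open import Data.List.Properties using (++-identityʳ; ∷ʳ-++)
open import Data.List.Relation.Binary.Pointwise using (Pointwise; []; _∷_)
open import Data.List.Relation.Unary.All as All using (All; []; _∷_)
open import Data.List.Relation.Unary.All.Properties as All using ()
open import Data.List.Relation.Unary.AllPairs using (AllPairs; []; _∷_)
open import Data.List.Relation.Unary.Any using (Any; here; there)
open import Data.Maybe as Maybe using (Maybe; just; nothing)
open import Data.Maybe.Properties using (map-id)
open import Data.Nat using (ℕ; zero; suc; _≤_; _<_; s≤s)
open import Data.Nat.Properties using (≤-refl; m⊔n≤o⇒m≤o; m⊔n≤o⇒n≤o; <-cmp)
open import Data.Product using (_×_; _,_; proj₁; proj₂; ∃; ∃₂; map₁; map₂)
open import Data.Sum using (_⊎_; inj₁; inj₂; [_,_]′)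
open import Data.Unit using (⊤; tt)
open import Data.Vec using (Vec; toList)
open import Data.Vec.Functional using (updateAt)
open import Data.Vec.Functional.Properties using (updateAt-updates; updateAt-minimal)
open import Function using (_∘_; _on_)
open import Relation.Binary using (tri<; tri≈; tri>)
open import Relation.Binary.PropositionalEquality
open ≡-Reasoning
open import Relation.Nullary using (¬_; Dec; yes; no; does)
open import Relation.Nullary.Decidable using (dec-true)

private
  variable
    n : ℕ

-- Walks in decision trees

-- A step of a root-to-leaf walk: the queried variable, the label of the edge
-- taken, and whether the node queried has two children.
Step : ℕ → Set
Step n = Fin n × Bool × Bool

Walk : ℕ → Set
Walk n = List (Step n)

var : Step n → Fin n
var = proj₁

label : Step n → Bool
label s = proj₁ (proj₂ s)

walkRestr : Walk n → OrdRestr n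
walkRestr [] = []
walkRestr ((v , c , _) ∷ w) = (v , c) ∷ walkRestr w

branchLabels : Walk n → List Bool
branchLabels [] = []
branchLabels ((_ , c , true)  ∷ w) = c ∷ branchLabels w
branchLabels ((_ , _ , false) ∷ w) = branchLabels w

data Child {n : ℕ} : DT n → Step n → DT n → Set where
  only0 : ∀ {x l}   → Child (node x (just l) nothing)  (x , false , false) l
  only1 : ∀ {x r}   → Child (node x nothing (just r))  (x , true  , false) r
  fork0 : ∀ {x l r} → Child (node x (just l) (just r)) (x , false , true)  l
  fork1 : ∀ {x l r} → Child (node x (just l) (just r)) (x , true  , true)  r

infixr 5 _◂_

data Reaches {n : ℕ} : DT n → Walk n → Bool → Set where
  end : ∀ {c} → Reaches (leaf c) [] c
  _◂_ : ∀ {t s u w c} → Child t s u → Reaches u w c → Reaches t (s ∷ w) c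

walk-sound : ∀ b (t : DT n) a acc {α} → walk b t a acc ≡ just α →
             ∃ λ w → Reaches t w b × branchLabels w ≡ a × α ≡ acc ++ walkRestr w
walk-sound b (leaf c) [] acc eq with c ≟B b
walk-sound b (leaf c) [] acc refl | yes refl = [] , end , refl , sym (++-identityʳ acc)
walk-sound b (node x (just l) nothing) a acc eq with walk-sound b l a _ eq
... | w , r , refl , refl = _ , only0 ◂ r , refl , ∷ʳ-++ acc _ _
walk-sound b (node x nothing (just r)) a acc eq with walk-sound b r a _ eq
... | w , r , refl , refl = _ , only1 ◂ r , refl , ∷ʳ-++ acc _ _
walk-sound b (node x (just l) (just r)) (false ∷ a) acc eq with walk-sound b l a _ eq
... | w , r , refl , refl = _ , fork0 ◂ r , refl , ∷ʳ-++ acc _ _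
walk-sound b (node x (just l) (just r)) (true ∷ a) acc eq with walk-sound b r a _ eq
... | w , r , refl , refl = _ , fork1 ◂ r , refl , ∷ʳ-++ acc _ _

walk-complete : ∀ b {t : DT n} {w} acc → Reaches t w b → walk b t (branchLabels w) acc ≡ just (acc ++ walkRestr w)
walk-complete b acc end with b ≟B b
... | yes _ = cong just (sym (++-identityʳ acc))
... | no b≢b = ⊥-elim (b≢b refl)
walk-complete b acc (only0 ◂ r) = trans (walk-complete b _ r) (cong just (∷ʳ-++ acc _ _))
walk-complete b acc (only1 ◂ r) = trans (walk-complete b _ r) (cong just (∷ʳ-++ acc _ _))
walk-complete b acc (fork0 ◂ r) = trans (walk-complete b _ r) (cong just (∷ʳ-++ acc _ _))
walk-complete b acc (fork1 ◂ r) = trans (walk-complete b _ r) (cong just (∷ʳ-++ acc _ _))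

-- Restrictions and evaluation

Extends : (Fin n → Bool) → Restriction n → Set
Extends x σ = ∀ v d → σ v ≡ just d → x v ≡ d

override : Restriction n → (Fin n → Bool) → Fin n → Bool
override σ x v with σ v
... | just d  = d
... | nothing = x v

override-extends : ∀ (σ : Restriction n) x → Extends (override σ x) σ
override-extends σ x v d eq with σ v
override-extends σ x v d refl | just .d = refl

override-free : ∀ (σ : Restriction n) x v → σ v ≡ nothing → override σ x v ≡ x v
override-free σ x v eq with σ v
override-free σ x v refl | nothing = refl

Extends-≼ : ∀ {σ' σ : Restriction n} {x} → σ' ≼ σ → Extends x σ' → Extends x σ
Extends-≼ {σ' = σ'} (stars , consistent) ext v d eq with σ' v in eq'
... | just d' = trans (ext v d' eq') (consistent v d' d eq' eq)
... | nothing with () ← trans (sym eq) (stars v eq')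

module _ {σ : Restriction n} {x y : Fin n → Bool}
         (y⊨σ : Extends y σ) (y≈x : ∀ v → σ v ≡ nothing → y v ≡ x v) where

  mutual
    eval-restrictF : ∀ H → eval (restrictF H σ) x ≡ eval H y
    eval-restrictF (const c) = refl
    eval-restrictF (lit p v) with σ v in eq
    ... | just d  = cong (litVal p) (sym (y⊨σ v d eq))
    ... | nothing = cong (litVal p) (sym (y≈x v eq))
    eval-restrictF (or Fs)  = evalOr-restrictFs Fs
    eval-restrictF (and Fs) = evalAnd-restrictFs Fs

    evalOr-restrictFs : ∀ Fs → evalOr (restrictFs Fs σ) x ≡ evalOr Fs y
    evalOr-restrictFs []       = refl
    evalOr-restrictFs (F ∷ Fs) =
      cong₂ (λ u w → if u then true else w) (eval-restrictF F) (evalOr-restrictFs Fs)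

    evalAnd-restrictFs : ∀ Fs → evalAnd (restrictFs Fs σ) x ≡ evalAnd Fs y
    evalAnd-restrictFs []       = refl
    evalAnd-restrictFs (F ∷ Fs) =
      cong₂ (λ u w → if u then w else false) (eval-restrictF F) (evalAnd-restrictFs Fs)

eval-restrictF-extends : ∀ (H : Formula n) {σ x} → Extends x σ → eval (restrictF H σ) x ≡ eval H x
eval-restrictF-extends H x⊨σ = eval-restrictF x⊨σ (λ _ _ → refl) H

RestrictsTo-intro : ∀ (H : Formula n) {σ c} → (∀ x → Extends x σ → eval H x ≡ c) → RestrictsTo H σ c
RestrictsTo-intro H {σ} h x =
  trans (eval-restrictF (override-extends σ x) (override-free σ x) H) (h _ (override-extends σ x))

RestrictsTo-elim : ∀ (H : Formula n) {σ c x} → RestrictsTo H σ c → Extends x σ → eval H x ≡ c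
RestrictsTo-elim H H|σ≡c x⊨σ = trans (sym (eval-restrictF-extends H x⊨σ)) (H|σ≡c _)

RestrictsTo-≼ : ∀ (H : Formula n) {σ' σ c} → σ' ≼ σ → RestrictsTo H σ c → RestrictsTo H σ' c
RestrictsTo-≼ H σ'≼σ H|σ≡c = RestrictsTo-intro H (λ x x⊨σ' → RestrictsTo-elim H H|σ≡c (Extends-≼ σ'≼σ x⊨σ'))

RestrictsTo-unique : ∀ {H : Formula n} {σ c} → RestrictsTo H σ c → ¬ RestrictsTo H σ (not c)
RestrictsTo-unique H|σ≡c H|σ≡¬c = not-¬ refl (trans (sym (H|σ≡c _)) (H|σ≡¬c (λ _ → false)))

infix 4 _⊢_⇓_

data _⊢_⇓_ {n : ℕ} (x : Fin n → Bool) : DT n → Bool → Set where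
  end  : ∀ {c} → x ⊢ leaf c ⇓ c
  step : ∀ {t s u c} → Child t s u → x (var s) ≡ label s → x ⊢ u ⇓ c → x ⊢ t ⇓ c

⇓-leaf : ∀ {x : Fin n → Bool} {c d} → c ≡ d → x ⊢ leaf c ⇓ d
⇓-leaf refl = end

Follows : (Fin n → Bool) → Walk n → Set
Follows x = All (λ s → x (var s) ≡ label s)

Child-deterministic : ∀ (x : Fin n → Bool) {t s s' u u'} → Child t s u → Child t s' u' →
                      x (var s) ≡ label s → x (var s') ≡ label s' → u ≡ u'
Child-deterministic _ only0 only0 _ _ = refl
Child-deterministic _ only1 only1 _ _ = refl
Child-deterministic _ fork0 fork0 _ _ = refl
Child-deterministic _ fork1 fork1 _ _ = refl
Child-deterministic _ fork0 fork1 e e' with () ← trans (sym e) e'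
Child-deterministic _ fork1 fork0 e e' with () ← trans (sym e) e'

⇓-functional : ∀ {x : Fin n → Bool} {t c d} → x ⊢ t ⇓ c → x ⊢ t ⇓ d → c ≡ d
⇓-functional end end = refl
⇓-functional {x = x} (step k e p) (step k' e' p') with refl ← Child-deterministic x k k' e e' = ⇓-functional p p'

Reaches⇒⇓ : ∀ {x : Fin n → Bool} {t w c} → Reaches t w c → Follows x w → x ⊢ t ⇓ c
Reaches⇒⇓ end [] = end
Reaches⇒⇓ (k ◂ r) (e ∷ f) = step k e (Reaches⇒⇓ r f)

⇓⇒Reaches : ∀ {x : Fin n → Bool} {t c} → x ⊢ t ⇓ c → ∃ λ w → Reaches t w c × Follows x w
⇓⇒Reaches end = [] , end , []
⇓⇒Reaches (step k e p) with w , r , f ← ⇓⇒Reaches p = _ , k ◂ r , e ∷ f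

-- Restricting, relabelling and contracting trees

-- How a step of t appears in applyR σ t: a node whose variable σ fixes keeps one child.
data PrunedStep (σ : Restriction n) : Step n → Step n → Set where
  free  : ∀ {v c g} → σ v ≡ nothing → PrunedStep σ (v , c , g) (v , c , g)
  fixed : ∀ {v c g} → σ v ≡ just c  → PrunedStep σ (v , c , g) (v , c , false)

PrunedStep-var : ∀ {σ : Restriction n} {s s'} → PrunedStep σ s s' → var s ≡ var s'
PrunedStep-var (free _)  = refl
PrunedStep-var (fixed _) = refl

Pruned : Restriction n → Walk n → Walk n → Set
Pruned σ = Pointwise (PrunedStep σ)

applyR-child : ∀ σ {t : DT n} {s s' u} → Child t s u → PrunedStep σ s s' → Child (applyR σ t) s' (applyR σ u)
applyR-child σ only0 (free  e) rewrite e = only0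
applyR-child σ only0 (fixed e) rewrite e = only0
applyR-child σ only1 (free  e) rewrite e = only1
applyR-child σ only1 (fixed e) rewrite e = only1
applyR-child σ fork0 (free  e) rewrite e = fork0
applyR-child σ fork0 (fixed e) rewrite e = only0
applyR-child σ fork1 (free  e) rewrite e = fork1
applyR-child σ fork1 (fixed e) rewrite e = only1

applyR-child⁻ : ∀ σ (t : DT n) {s' u'} → Child (applyR σ t) s' u' →
                ∃₂ λ s u → Child t s u × PrunedStep σ s s' × u' ≡ applyR σ u
applyR-child⁻ σ (node x m₀ m₁) k with σ x in e
applyR-child⁻ σ (node x (just l) nothing)  only0 | just false = _ , _ , only0 , fixed e , refl
applyR-child⁻ σ (node x (just l) (just r)) only0 | just false = _ , _ , fork0 , fixed e , refl
applyR-child⁻ σ (node x nothing (just r))  only1 | just true  = _ , _ , only1 , fixed e , refl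
applyR-child⁻ σ (node x (just l) (just r)) only1 | just true  = _ , _ , fork1 , fixed e , refl
applyR-child⁻ σ (node x (just l) nothing)  only0 | nothing    = _ , _ , only0 , free e , refl
applyR-child⁻ σ (node x nothing (just r))  only1 | nothing    = _ , _ , only1 , free e , refl
applyR-child⁻ σ (node x (just l) (just r)) fork0 | nothing    = _ , _ , fork0 , free e , refl
applyR-child⁻ σ (node x (just l) (just r)) fork1 | nothing    = _ , _ , fork1 , free e , refl

applyR-reaches : ∀ σ {t : DT n} {w w' c} → Reaches t w c → Pruned σ w w' → Reaches (applyR σ t) w' c
applyR-reaches σ end     []      = end
applyR-reaches σ (k ◂ r) (p ∷ ps) = applyR-child σ k p ◂ applyR-reaches σ r ps

applyR-reaches⁻ : ∀ σ (t : DT n) {w' c} → Reaches (applyR σ t) w' c → ∃ λ w → Reaches t w c × Pruned σ w w'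
applyR-reaches⁻ σ (leaf c) end = [] , end , []
applyR-reaches⁻ σ (node x _ _) {[]} r with σ x
applyR-reaches⁻ σ (node x _ _) () | just false
applyR-reaches⁻ σ (node x _ _) () | just true
applyR-reaches⁻ σ (node x _ _) () | nothing
applyR-reaches⁻ σ t@(node _ _ _) (k ◂ r)
  with s , u , k° , p , refl ← applyR-child⁻ σ t k
  with w , r° , ps ← applyR-reaches⁻ σ u r = s ∷ w , k° ◂ r° , p ∷ ps

Pruned-follows : ∀ {σ : Restriction n} {x w w'} → Pruned σ w w' → Follows x w → Follows x w'
Pruned-follows []             []       = []
Pruned-follows (free  _ ∷ ps) (e ∷ es) = e ∷ Pruned-follows ps es
Pruned-follows (fixed _ ∷ ps) (e ∷ es) = e ∷ Pruned-follows ps es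

prune : ∀ {σ : Restriction n} {x} w → Extends x σ → Follows x w → ∃ λ w' → Pruned σ w w'
prune [] x⊨σ [] = [] , []
prune {σ = σ} ((v , c , g) ∷ w) x⊨σ (e ∷ es) with w' , ps ← prune w x⊨σ es | σ v in σv
... | nothing = _ , free σv ∷ ps
... | just d with refl ← trans (sym (x⊨σ v d σv)) e = _ , fixed σv ∷ ps

applyR-⇓ : ∀ σ {t : DT n} {x c} → Extends x σ → x ⊢ t ⇓ c → x ⊢ applyR σ t ⇓ c
applyR-⇓ σ x⊨σ p with w , r , f ← ⇓⇒Reaches p with w' , ps ← prune w x⊨σ f =
  Reaches⇒⇓ (applyR-reaches σ r ps) (Pruned-follows ps f)

relabel-child : ∀ b {t : DT n} {s u} → Child t s u → Child (relabel b t) s (relabel b u)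
relabel-child b only0 = only0
relabel-child b only1 = only1
relabel-child b fork0 = fork0
relabel-child b fork1 = fork1

relabel-child⁻ : ∀ b (t : DT n) {s u'} → Child (relabel b t) s u' → ∃ λ u → Child t s u × u' ≡ relabel b u
relabel-child⁻ b (node x (just l) nothing)  only0 = _ , only0 , refl
relabel-child⁻ b (node x nothing (just r))  only1 = _ , only1 , refl
relabel-child⁻ b (node x (just l) (just r)) fork0 = _ , fork0 , refl
relabel-child⁻ b (node x (just l) (just r)) fork1 = _ , fork1 , refl

relabel-reaches : ∀ b {t : DT n} {w c} → Reaches t w c → Reaches (relabel b t) w b
relabel-reaches b end     = end
relabel-reaches b (k ◂ r) = relabel-child b k ◂ relabel-reaches b r

relabel-reaches⁻ : ∀ b (t : DT n) {w c} → Reaches (relabel b t) w c → c ≡ b × ∃ λ d → Reaches t w d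
relabel-reaches⁻ b (leaf d) end = refl , d , end
relabel-reaches⁻ b t@(node _ _ _) (k ◂ r)
  with u , k° , refl ← relabel-child⁻ b t k
  with refl , d , r° ← relabel-reaches⁻ b u r = refl , d , k° ◂ r°

relabel-⇓ : ∀ b {t : DT n} {x c} → x ⊢ t ⇓ c → x ⊢ relabel b t ⇓ b
relabel-⇓ b p with w , r , f ← ⇓⇒Reaches p = Reaches⇒⇓ (relabel-reaches b r) f

∧-true⁻ : ∀ {x y} → x ∧ y ≡ true → x ≡ true × y ≡ true
∧-true⁻ {true} {true} refl = refl , refl

∧-falseˡ : ∀ {x y} → x ≡ true → x ∧ y ≡ false → y ≡ false
∧-falseˡ refl e = e

∧-falseʳ : ∀ {x y} → y ≡ true → x ∧ y ≡ false → x ≡ false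
∧-falseʳ {x} refl e = trans (sym (∧-identityʳ x)) e

allLeaves-child : ∀ b {t : DT n} {s u} → Child t s u → allLeaves b t ≡ true → allLeaves b u ≡ true
allLeaves-child b only0 all = trans (sym (∧-identityʳ _)) all
allLeaves-child b only1 all = all
allLeaves-child b fork0 all = proj₁ (∧-true⁻ all)
allLeaves-child b fork1 all = proj₂ (∧-true⁻ all)

allLeaves-reaches : ∀ b {t : DT n} {w c} → Reaches t w c → allLeaves b t ≡ true → c ≡ b
allLeaves-reaches b (end {c}) all with c ≟B b
... | yes c≡b = c≡b
allLeaves-reaches b (k ◂ r) all = allLeaves-reaches b r (allLeaves-child b k all)

¬allLeaves-reaches : ∀ b (t : DT n) → allLeaves b t ≡ false → ∃₂ λ w c → Reaches t w c × c ≢ b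
¬allLeaves-reaches b (leaf c) all with c ≟B b
... | no c≢b = [] , c , end , c≢b
¬allLeaves-reaches b (node x (just l) nothing) all
  with w , c , r , c≢b ← ¬allLeaves-reaches b l (∧-falseʳ refl all) = _ , c , only0 ◂ r , c≢b
¬allLeaves-reaches b (node x nothing (just r)) all
  with w , c , r , c≢b ← ¬allLeaves-reaches b r all = _ , c , only1 ◂ r , c≢b
¬allLeaves-reaches b (node x (just l) (just r)) all with allLeaves b l in allₗ
... | false with w , c , r , c≢b ← ¬allLeaves-reaches b l allₗ = _ , c , fork0 ◂ r , c≢b
... | true  with w , c , r , c≢b ← ¬allLeaves-reaches b r all  = _ , c , fork1 ◂ r , c≢b

contractChildren : Bool → DT n → DT n
contractChildren b (leaf c)       = leaf c
contractChildren b (node x m₀ m₁) = node x (contractM b m₀) (contractM b m₁)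

data ContractView (b : Bool) (t : DT n) : DT n → Set where
  collapsed : allLeaves b (contractChildren b t) ≡ true  → ContractView b t (leaf b)
  kept      : allLeaves b (contractChildren b t) ≡ false → ContractView b t (contractChildren b t)

contract-view : ∀ b (t : DT n) → ContractView b t (contract b t)
contract-view b (leaf c) with c ≟B b in eq
... | yes refl = collapsed (cong does eq)
... | no _     = kept (cong does eq)
contract-view b (node x m₀ m₁) with allLeaves b (contractChildren b (node x m₀ m₁)) in all
... | true  = collapsed all
... | false = kept all

contract-child : ∀ b {t : DT n} {s u} → Child t s u → Child (contractChildren b t) s (contract b u)
contract-child b only0 = only0
contract-child b only1 = only1
contract-child b fork0 = fork0
contract-child b fork1 = fork1

contract-child⁻ : ∀ b (t : DT n) {s u'} → Child (contractChildren b t) s u' → ∃ λ u → Child t s u × u' ≡ contract b u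
contract-child⁻ b (node x (just l) nothing)  only0 = _ , only0 , refl
contract-child⁻ b (node x nothing (just r))  only1 = _ , only1 , refl
contract-child⁻ b (node x (just l) (just r)) fork0 = _ , fork0 , refl
contract-child⁻ b (node x (just l) (just r)) fork1 = _ , fork1 , refl

contract-reaches⁻ : ∀ b (t : DT n) {w c} → Reaches (contract b t) w c → c ≢ b → Reaches t w c
contract-reaches⁻ b t r c≢b with contract b t | contract-view b t
contract-reaches⁻ b t end c≢b | _ | collapsed _ = ⊥-elim (c≢b refl)
contract-reaches⁻ b (leaf c) end c≢b | _ | kept _ = end
contract-reaches⁻ b t@(node _ _ _) (k ◂ r) c≢b | _ | kept _
  with u , k° , refl ← contract-child⁻ b t k = k° ◂ contract-reaches⁻ b u r c≢b

mutual
  contract-reaches : ∀ b {t : DT n} {w c} → Reaches t w c → c ≢ b → Reaches (contract b t) w c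
  contract-reaches b {t} r c≢b with contract b t | contract-view b t
  ... | _ | collapsed all = ⊥-elim (c≢b (allLeaves-reaches b (contractChildren-reaches b r c≢b) all))
  ... | _ | kept _        = contractChildren-reaches b r c≢b

  contractChildren-reaches : ∀ b {t : DT n} {w c} → Reaches t w c → c ≢ b → Reaches (contractChildren b t) w c
  contractChildren-reaches b end     c≢b = end
  contractChildren-reaches b (k ◂ r) c≢b = contract-child b k ◂ contract-reaches b r c≢b

mutual
  contract-⇓ : ∀ b {t : DT n} {x c} → x ⊢ t ⇓ c → x ⊢ contract b t ⇓ c
  contract-⇓ b {t} p with contract b t | contract-view b t
  ... | _ | kept _ = contractChildren-⇓ b p
  ... | _ | collapsed all with w , r , _ ← ⇓⇒Reaches (contractChildren-⇓ b p)
                           with refl ← allLeaves-reaches b r all = end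

  contractChildren-⇓ : ∀ b {t : DT n} {x c} → x ⊢ t ⇓ c → x ⊢ contractChildren b t ⇓ c
  contractChildren-⇓ b end          = end
  contractChildren-⇓ b (step k e p) = step (contract-child b k) e (contract-⇓ b p)

Permits : Restriction n → Fin n → Bool → Set
Permits σ v c = σ v ≡ nothing ⊎ σ v ≡ just c

mutual
  -- The edge labelled c out of a node querying v is present iff σ permits v ↦ c.
  Fits : Restriction n → DT n → Set
  Fits σ (leaf _)       = ⊤
  Fits σ (node v m₀ m₁) = FitsEdge σ v false m₀ × FitsEdge σ v true m₁

  FitsEdge : Restriction n → Fin n → Bool → Maybe (DT n) → Set
  FitsEdge σ v c nothing  = σ v ≡ just (not c)
  FitsEdge σ v c (just t) = Permits σ v c × Fits σ t

Fits-child : ∀ {σ : Restriction n} {t s u} → Fits σ t → Child t s u → Permits σ (var s) (label s) × Fits σ u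
Fits-child (e₀ , _)  only0 = e₀
Fits-child (_  , e₁) only1 = e₁
Fits-child (e₀ , _)  fork0 = e₀
Fits-child (_  , e₁) fork1 = e₁

Permits-fixed : ∀ {σ : Restriction n} {v c d} → Permits σ v c → σ v ≡ just d → c ≡ d
Permits-fixed (inj₁ σv) σv' with () ← trans (sym σv') σv
Permits-fixed (inj₂ σv) σv' with refl ← trans (sym σv) σv' = refl

ConsistentWalk : Restriction n → Walk n → Set
ConsistentWalk σ = All (λ s → Permits σ (var s) (label s))

Fits-consistent : ∀ {σ : Restriction n} {t w c} → Fits σ t → Reaches t w c → ConsistentWalk σ w
Fits-consistent fits end     = []
Fits-consistent fits (k ◂ r) = proj₁ (Fits-child fits k) ∷ Fits-consistent (proj₂ (Fits-child fits k)) r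

Fits-⇓ : ∀ {σ : Restriction n} (t : DT n) {x} → Fits σ t → Extends x σ → ∃ λ c → x ⊢ t ⇓ c
Fits-⇓ (leaf c) _ _ = c , end
Fits-⇓ (node v m₀ m₁) {x} _ _ with x v in xv
Fits-⇓ (node v (just l) nothing)  ((_ , f) , _) x⊨σ | false = map₂ (step only0 xv) (Fits-⇓ l f x⊨σ)
Fits-⇓ (node v (just l) (just _)) ((_ , f) , _) x⊨σ | false = map₂ (step fork0 xv) (Fits-⇓ l f x⊨σ)
Fits-⇓ (node v nothing _)         (e , _)       x⊨σ | false with () ← trans (sym xv) (x⊨σ v true e)
Fits-⇓ (node v nothing (just r))  (_ , (_ , f)) x⊨σ | true  = map₂ (step only1 xv) (Fits-⇓ r f x⊨σ)
Fits-⇓ (node v (just _) (just r)) (_ , (_ , f)) x⊨σ | true  = map₂ (step fork1 xv) (Fits-⇓ r f x⊨σ)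
Fits-⇓ (node v _ nothing)         (_ , e)       x⊨σ | true  with () ← trans (sym xv) (x⊨σ v false e)

mutual
  applyR-Fits : ∀ {σ σ₀ : Restriction n} t → σ ≼ σ₀ → Fits σ₀ t → Fits σ (applyR σ t)
  applyR-Fits (leaf _) _ _ = tt
  applyR-Fits {σ = σ} (node v m₀ m₁) σ≼σ₀ (e₀ , e₁) with σ v in σv
  ... | just false = applyR-FitsEdge m₀ σ≼σ₀ (inj₂ σv) e₀ , σv
  ... | just true  = σv , applyR-FitsEdge m₁ σ≼σ₀ (inj₂ σv) e₁
  ... | nothing    = applyR-FitsEdge m₀ σ≼σ₀ (inj₁ σv) e₀ , applyR-FitsEdge m₁ σ≼σ₀ (inj₁ σv) e₁

  applyR-FitsEdge : ∀ {σ σ₀ : Restriction n} {v c} m → σ ≼ σ₀ → Permits σ v c →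
                    FitsEdge σ₀ v c m → FitsEdge σ v c (applyRM σ m)
  applyR-FitsEdge (just t) σ≼σ₀ perm (_ , fits) = perm , applyR-Fits t σ≼σ₀ fits
  applyR-FitsEdge {v = v} nothing (stars , _) (inj₁ σv) e with () ← trans (sym e) (stars v σv)
  applyR-FitsEdge {v = v} {c} nothing (_ , consistent) (inj₂ σv) e = ⊥-elim (not-¬ refl (consistent v c (not c) σv e))

mutual
  relabel-Fits : ∀ {σ : Restriction n} b t → Fits σ t → Fits σ (relabel b t)
  relabel-Fits b (leaf _) _ = tt
  relabel-Fits b (node _ m₀ m₁) (e₀ , e₁) = relabel-FitsEdge b m₀ e₀ , relabel-FitsEdge b m₁ e₁

  relabel-FitsEdge : ∀ {σ : Restriction n} {v c} b m → FitsEdge σ v c m → FitsEdge σ v c (relabelM b m)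
  relabel-FitsEdge b nothing  e            = e
  relabel-FitsEdge b (just t) (perm , fits) = perm , relabel-Fits b t fits

mutual
  contract-Fits : ∀ {σ : Restriction n} b t → Fits σ t → Fits σ (contract b t)
  contract-Fits b t fits with contract b t | contract-view b t
  ... | _ | collapsed _ = tt
  ... | _ | kept _      = contractChildren-Fits b t fits

  contractChildren-Fits : ∀ {σ : Restriction n} b t → Fits σ t → Fits σ (contractChildren b t)
  contractChildren-Fits b (leaf _) _ = tt
  contractChildren-Fits b (node _ m₀ m₁) (e₀ , e₁) = contract-FitsEdge b m₀ e₀ , contract-FitsEdge b m₁ e₁

  contract-FitsEdge : ∀ {σ : Restriction n} {v c} b m → FitsEdge σ v c m → FitsEdge σ v c (contractM b m)
  contract-FitsEdge b nothing  e            = e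
  contract-FitsEdge b (just t) (perm , fits) = perm , contract-Fits b t fits

mutual
  Contracted : Bool → DT n → Set
  Contracted b (leaf _)         = ⊤
  Contracted b t@(node _ m₀ m₁) = allLeaves b t ≡ false × ContractedM b m₀ × ContractedM b m₁

  ContractedM : Bool → Maybe (DT n) → Set
  ContractedM b nothing  = ⊤
  ContractedM b (just t) = Contracted b t

mutual
  contract-Contracted : ∀ b (t : DT n) → Contracted b (contract b t)
  contract-Contracted b t with contract b t | contract-view b t
  contract-Contracted b t              | _ | collapsed _ = tt
  contract-Contracted b (leaf _)       | _ | kept _      = tt
  contract-Contracted b (node _ m₀ m₁) | _ | kept all    = all , contractM-Contracted b m₀ , contractM-Contracted b m₁

  contractM-Contracted : ∀ b (m : Maybe (DT n)) → ContractedM b (contractM b m)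
  contractM-Contracted b nothing  = tt
  contractM-Contracted b (just t) = contract-Contracted b t

Contracted-all-b : ∀ {b} (t : DT n) → Contracted b t → (∀ {w d} → Reaches t w d → d ≡ b) → t ≡ leaf b
Contracted-all-b (leaf c) _ all-b = cong leaf (all-b end)
Contracted-all-b {b = b} t@(node _ _ _) (all , _) all-b
  with w , d , r , d≢b ← ¬allLeaves-reaches b t all = ⊥-elim (d≢b (all-b r))

data Queries {n : ℕ} (v : Fin n) : DT n → Set where
  here  : ∀ {t s u} → Child t s u → var s ≡ v → Queries v t
  there : ∀ {t s u} → Child t s u → Queries v u → Queries v t

data RepetitionFree {n : ℕ} : DT n → Set where
  repetitionFree : ∀ {t} → (∀ {s u} → Child t s u → ¬ Queries (var s) u × RepetitionFree u) → RepetitionFree t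

DistinctVars : Walk n → Set
DistinctVars = AllPairs (_≢_ on var)

¬Queries-fresh : ∀ {v} {u : DT n} {w c} → ¬ Queries v u → Reaches u w c → All (λ s → v ≢ var s) w
¬Queries-fresh ¬q end     = []
¬Queries-fresh ¬q (k ◂ r) = (λ e → ¬q (here k (sym e))) ∷ ¬Queries-fresh (¬q ∘ there k) r

RepetitionFree-distinct : ∀ {t : DT n} {w c} → RepetitionFree t → Reaches t w c → DistinctVars w
RepetitionFree-distinct _ end = []
RepetitionFree-distinct (repetitionFree rf) (k ◂ r) with ¬q , rfᵤ ← rf k =
  ¬Queries-fresh ¬q r ∷ RepetitionFree-distinct rfᵤ r

witness : ∀ (σ : Restriction n) w → DistinctVars w → ConsistentWalk σ w → ∃ λ x → Follows x w × Extends x σ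
witness σ [] [] [] = override σ (λ _ → false) , [] , override-extends σ _
witness σ ((v , c , _) ∷ w) (fresh ∷ distinct) (perm ∷ perms) with x , follows , x⊨σ ← witness σ w distinct perms =
  x' , updateAt-updates v {λ _ → c} x ∷ still-follows fresh follows , x'⊨σ
  where
  x' : Fin _ → Bool
  x' = updateAt x v (λ _ → c)

  still-follows : ∀ {w'} → All (λ s → v ≢ var s) w' → Follows x w' → Follows x' w'
  still-follows []           []       = []
  still-follows (v≢s ∷ fresh) (e ∷ es) = trans (updateAt-minimal _ v x (v≢s ∘ sym)) e ∷ still-follows fresh es

  x'⊨σ : Extends x' σ
  x'⊨σ u d σu with u ≟ v
  ... | no u≢v = trans (updateAt-minimal u v x u≢v) (x⊨σ u d σu)
  ... | yes refl = trans (updateAt-updates v x) (Permits-fixed {σ = σ} perm σu)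

-- Balancing

mutual
  balanceRec : Bool → DT n → DT n
  balanceRec b (leaf c) = leaf c
  balanceRec b (node x (just l) (just r)) = node x (just (balanceSide b l r)) (just (balanceSide b r l))
  balanceRec b (node x m₀ m₁) = node x (balanceRecM b m₀) (balanceRecM b m₁)

  balanceRecM : Bool → Maybe (DT n) → Maybe (DT n)
  balanceRecM b nothing  = nothing
  balanceRecM b (just t) = just (balanceRec b t)

  balanceSide : Bool → DT n → DT n → DT n
  balanceSide b l r = if isLeaf b l then relabel b (balanceRec b r) else balanceRec b l

mapChildren : (DT n → DT n) → DT n → DT n
mapChildren f (leaf c)       = leaf c
mapChildren f (node x m₀ m₁) = node x (Maybe.map f m₀) (Maybe.map f m₁)

balanceSteps-leaf : ∀ b j c → balanceSteps {n} b j (leaf c) ≡ leaf c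
balanceSteps-leaf b zero    c = refl
balanceSteps-leaf b (suc j) c = trans (cong (balanceSteps b j) (replaceAt-leaf j)) (balanceSteps-leaf b j c)
  where
  replaceAt-leaf : ∀ k → replaceAt b k (leaf c) ≡ leaf c
  replaceAt-leaf zero          = refl
  replaceAt-leaf (suc zero)    = refl
  replaceAt-leaf (suc (suc k)) = refl

-- The steps at depths j, …, 1 act on the children only, one level lower.
balanceSteps-suc : ∀ b j (t : DT n) →
                   balanceSteps b (suc (suc j)) t ≡ replaceAt b 1 (mapChildren (balanceSteps b (suc j)) t)
balanceSteps-suc b zero    (leaf c) = refl
balanceSteps-suc b zero    (node x m₀ m₁) = cong₂ (λ u v → replaceAt b 1 (node x u v)) (sym (map-id m₀)) (sym (map-id m₁))
balanceSteps-suc b (suc j) t = trans (balanceSteps-suc b j (replaceAt b (suc (suc j)) t)) (cong (replaceAt b 1) (lower t))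
  where
  lower : ∀ t → mapChildren (balanceSteps b (suc j)) (replaceAt b (suc (suc j)) t) ≡ mapChildren (balanceSteps b (suc (suc j))) t
  lower (leaf c) = refl
  lower (node x m₀ m₁) = cong₂ (node x) (lowerM m₀) (lowerM m₁)
    where
    lowerM : ∀ m → Maybe.map (balanceSteps b (suc j)) (replaceAtM b (suc j) m) ≡ Maybe.map (balanceSteps b (suc (suc j))) m
    lowerM nothing  = refl
    lowerM (just _) = refl

isLeaf-balanceRec : ∀ b (t : DT n) → isLeaf b (balanceRec b t) ≡ isLeaf b t
isLeaf-balanceRec b (leaf _)                   = refl
isLeaf-balanceRec b (node _ nothing nothing)   = refl
isLeaf-balanceRec b (node _ nothing (just _))  = refl
isLeaf-balanceRec b (node _ (just _) nothing)  = refl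
isLeaf-balanceRec b (node _ (just _) (just _)) = refl

replaceAt-balanceRec : ∀ b x (m₀ m₁ : Maybe (DT n)) →
                       replaceAt b 1 (node x (balanceRecM b m₀) (balanceRecM b m₁)) ≡ balanceRec b (node x m₀ m₁)
replaceAt-balanceRec b x (just l) (just r) rewrite isLeaf-balanceRec b l | isLeaf-balanceRec b r = refl
replaceAt-balanceRec b x nothing  nothing  = refl
replaceAt-balanceRec b x nothing  (just _) = refl
replaceAt-balanceRec b x (just _) nothing  = refl

balanceSide-leaves : ∀ b c₀ c₁ → balanceSide {n} b (leaf c₀) (leaf c₁) ≡ leaf c₀
balanceSide-leaves b c₀ c₁ with c₀ ≟B b
... | yes refl = refl
... | no _     = refl

mutual
  balanceSteps-balanceRec : ∀ b j (t : DT n) → height t ≤ j → balanceSteps b j t ≡ balanceRec b t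
  balanceSteps-balanceRec b j (leaf c) _ = balanceSteps-leaf b j c
  balanceSteps-balanceRec b (suc zero) (node x m₀ m₁) (s≤s h) =
    shallow m₀ m₁ (m⊔n≤o⇒m≤o (heightM m₀) (heightM m₁) h) (m⊔n≤o⇒n≤o (heightM m₀) (heightM m₁) h)
    where
    shallow : ∀ m₀ m₁ → heightM m₀ ≤ 0 → heightM m₁ ≤ 0 → node x m₀ m₁ ≡ balanceRec b (node x m₀ m₁)
    shallow nothing          nothing          _ _ = refl
    shallow (just (leaf _))  nothing          _ _ = refl
    shallow nothing          (just (leaf _))  _ _ = refl
    shallow (just (leaf c₀)) (just (leaf c₁)) _ _ =
      sym (cong₂ (λ l r → node x (just l) (just r)) (balanceSide-leaves b c₀ c₁) (balanceSide-leaves b c₁ c₀))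
  balanceSteps-balanceRec b (suc (suc j)) t@(node x m₀ m₁) (s≤s h) =
    begin
      balanceSteps b (suc (suc j)) t
    ≡⟨ balanceSteps-suc b j t ⟩
      replaceAt b 1 (mapChildren (balanceSteps b (suc j)) t)
    ≡⟨ cong₂ (λ u v → replaceAt b 1 (node x u v))
             (balanceStepsM-balanceRecM b m₀ (m⊔n≤o⇒m≤o (heightM m₀) (heightM m₁) h))
             (balanceStepsM-balanceRecM b m₁ (m⊔n≤o⇒n≤o (heightM m₀) (heightM m₁) h)) ⟩
      replaceAt b 1 (node x (balanceRecM b m₀) (balanceRecM b m₁))
    ≡⟨ replaceAt-balanceRec b x m₀ m₁ ⟩
      balanceRec b t
    ∎

  balanceStepsM-balanceRecM : ∀ b {j} (m : Maybe (DT n)) → heightM m ≤ suc j →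
                              Maybe.map (balanceSteps b (suc j)) m ≡ balanceRecM b m
  balanceStepsM-balanceRecM b nothing  _ = refl
  balanceStepsM-balanceRecM b (just t) h = cong just (balanceSteps-balanceRec b _ t h)

balance≡balanceRec∘contract : ∀ b (t : DT n) → balance b t ≡ balanceRec b (contract b t)
balance≡balanceRec∘contract b t = balanceSteps-balanceRec b (height (contract b t)) (contract b t) ≤-refl

isLeaf-true : ∀ b (t : DT n) → isLeaf b t ≡ true → t ≡ leaf b
isLeaf-true b (leaf c) e with c ≟B b
isLeaf-true b (leaf c) e | yes refl = refl

reaches-¬isLeaf : ∀ b {t : DT n} {w d} → Reaches t w d → d ≢ b → isLeaf b t ≡ false
reaches-¬isLeaf b (end {d}) d≢b with d ≟B b
... | yes d≡b = ⊥-elim (d≢b d≡b)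
... | no _    = refl
reaches-¬isLeaf b {node _ _ _} (_ ◂ _) _ = refl

mutual
  balanceRec-Fits : ∀ {σ : Restriction n} b t → Fits σ t → Fits σ (balanceRec b t)
  balanceRec-Fits b (leaf _) _ = tt
  balanceRec-Fits b (node x (just l) (just r)) ((p₀ , fₗ) , (p₁ , fᵣ)) =
    (p₀ , balanceSide-Fits b l r fₗ fᵣ) , (p₁ , balanceSide-Fits b r l fᵣ fₗ)
  balanceRec-Fits b (node x nothing nothing)  fits              = fits
  balanceRec-Fits b (node x (just l) nothing) ((p₀ , fₗ) , e₁)  = (p₀ , balanceRec-Fits b l fₗ) , e₁
  balanceRec-Fits b (node x nothing (just r)) (e₀ , (p₁ , fᵣ))  = e₀ , (p₁ , balanceRec-Fits b r fᵣ)

  balanceSide-Fits : ∀ {σ : Restriction n} b l r → Fits σ l → Fits σ r → Fits σ (balanceSide b l r)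
  balanceSide-Fits b l r fₗ fᵣ with isLeaf b l
  ... | true  = relabel-Fits b _ (balanceRec-Fits b r fᵣ)
  ... | false = balanceRec-Fits b l fₗ

mutual
  balanceRec-⇓ : ∀ {σ : Restriction n} b t {x c} → Fits σ t → Extends x σ → x ⊢ t ⇓ c → x ⊢ balanceRec b t ⇓ c
  balanceRec-⇓ b (leaf _) _ _ end = end
  balanceRec-⇓ b (node _ (just l) nothing) ((_ , fₗ) , _) x⊨σ (step only0 e p) = step only0 e (balanceRec-⇓ b l fₗ x⊨σ p)
  balanceRec-⇓ b (node _ nothing (just r)) (_ , (_ , fᵣ)) x⊨σ (step only1 e p) = step only1 e (balanceRec-⇓ b r fᵣ x⊨σ p)
  balanceRec-⇓ b (node _ (just l) (just r)) ((_ , fₗ) , (_ , fᵣ)) x⊨σ (step fork0 e p) =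
    step fork0 e (balanceSide-⇓ b l r fₗ fᵣ x⊨σ p)
  balanceRec-⇓ b (node _ (just l) (just r)) ((_ , fₗ) , (_ , fᵣ)) x⊨σ (step fork1 e p) =
    step fork1 e (balanceSide-⇓ b r l fᵣ fₗ x⊨σ p)

  -- When l is a b-leaf, relabelling makes the sibling's output irrelevant, but
  -- the sibling must still be total on x, which Fits guarantees.
  balanceSide-⇓ : ∀ {σ : Restriction n} b l r {x c} → Fits σ l → Fits σ r → Extends x σ →
                  x ⊢ l ⇓ c → x ⊢ balanceSide b l r ⇓ c
  balanceSide-⇓ b l r fₗ fᵣ x⊨σ p with isLeaf b l in isLeafₗ
  ... | false = balanceRec-⇓ b l fₗ x⊨σ p
  ... | true with refl ← isLeaf-true b l isLeafₗ | end ← p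
             with _ , q ← Fits-⇓ r fᵣ x⊨σ = relabel-⇓ b (balanceRec-⇓ b r fᵣ x⊨σ q)

balanceRec-child⁻ : ∀ b (t : DT n) {s' u'} → Child (balanceRec b t) s' u' →
                    ∃₂ λ s u → Child t s u × var s ≡ var s' × (u' ≡ balanceRec b u ⊎ u' ≡ relabel b (balanceRec b u))
balanceRec-child⁻ b (node x (just l) nothing) only0 = _ , _ , only0 , refl , inj₁ refl
balanceRec-child⁻ b (node x nothing (just r)) only1 = _ , _ , only1 , refl , inj₁ refl
balanceRec-child⁻ b (node x (just l) (just r)) fork0 with isLeaf b l
... | true  = _ , _ , fork1 , refl , inj₂ refl
... | false = _ , _ , fork0 , refl , inj₁ refl
balanceRec-child⁻ b (node x (just l) (just r)) fork1 with isLeaf b r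
... | true  = _ , _ , fork0 , refl , inj₂ refl
... | false = _ , _ , fork1 , refl , inj₁ refl

balanceRec-b-prefix : ∀ b (t : DT n) {w} → Reaches (balanceRec b t) w b →
                      ∃₂ λ w₁ w₂ → w ≡ w₁ ++ w₂ × Reaches t w₁ b
balanceRec-b-prefix b (leaf _) end = [] , [] , refl , end
balanceRec-b-prefix b (node x (just l) nothing) (only0 ◂ r)
  with w₁ , w₂ , refl , r₁ ← balanceRec-b-prefix b l r = _ , w₂ , refl , only0 ◂ r₁
balanceRec-b-prefix b (node x nothing (just r)) (only1 ◂ q)
  with w₁ , w₂ , refl , r₁ ← balanceRec-b-prefix b r q = _ , w₂ , refl , only1 ◂ r₁
balanceRec-b-prefix b (node x (just l) (just r)) (fork0 ◂ q) with isLeaf b l in isLeafₗ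
... | true with refl ← isLeaf-true b l isLeafₗ = _ ∷ [] , _ , refl , fork0 ◂ end
... | false with w₁ , w₂ , refl , r₁ ← balanceRec-b-prefix b l q = _ , w₂ , refl , fork0 ◂ r₁
balanceRec-b-prefix b (node x (just l) (just r)) (fork1 ◂ q) with isLeaf b r in isLeafᵣ
... | true with refl ← isLeaf-true b r isLeafᵣ = _ ∷ [] , _ , refl , fork1 ◂ end
... | false with w₁ , w₂ , refl , r₁ ← balanceRec-b-prefix b r q = _ , w₂ , refl , fork1 ◂ r₁

does-false : ∀ {A : Set} (a? : Dec A) → does a? ≡ false → ¬ A
does-false a? e a with () ← trans (sym e) (dec-true a? a)

isLeaf⇒allLeaves : ∀ b (t : DT n) → isLeaf b t ≡ true → allLeaves b t ≡ true
isLeaf⇒allLeaves b (leaf _) e = e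

Contracted-¬isLeaf : ∀ {b} (t : DT n) → Contracted b t → isLeaf b t ≡ false → allLeaves b t ≡ false
Contracted-¬isLeaf (leaf _) _ e = e
Contracted-¬isLeaf (node _ _ _) (all , _) _ = all

-- A relabelled copy of a sibling is walked exactly like the sibling, hence the
-- equality of variable sequences.
balanceRec-non-b : ∀ b (t : DT n) {w c} → Contracted b t → allLeaves b t ≡ false → Reaches (balanceRec b t) w c →
                   ∃₂ λ w' d → Reaches t w' d × d ≢ b × map var w' ≡ map var w
balanceRec-non-b b (leaf c) _ all end = [] , c , end , does-false (c ≟B b) all , refl
balanceRec-non-b b (node x (just l) nothing) (_ , cₗ , _) all (only0 ◂ q)
  with w' , d , q' , d≢b , vars ← balanceRec-non-b b l cₗ (∧-falseʳ refl all) q =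
  _ , d , only0 ◂ q' , d≢b , cong (x ∷_) vars
balanceRec-non-b b (node x nothing (just r)) (_ , _ , cᵣ) all (only1 ◂ q)
  with w' , d , q' , d≢b , vars ← balanceRec-non-b b r cᵣ all q =
  _ , d , only1 ◂ q' , d≢b , cong (x ∷_) vars
balanceRec-non-b b (node x (just l) (just r)) (_ , cₗ , cᵣ) all (fork0 ◂ q) with isLeaf b l in isLeafₗ
... | false with w' , d , q' , d≢b , vars ← balanceRec-non-b b l cₗ (Contracted-¬isLeaf l cₗ isLeafₗ) q =
  _ , d , fork0 ◂ q' , d≢b , cong (x ∷_) vars
... | true with _ , _ , q'' ← relabel-reaches⁻ b (balanceRec b r) q
           with w' , d , q' , d≢b , vars ←
                  balanceRec-non-b b r cᵣ (∧-falseˡ (isLeaf⇒allLeaves b l isLeafₗ) all) q'' =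
  _ , d , fork1 ◂ q' , d≢b , cong (x ∷_) vars
balanceRec-non-b b (node x (just l) (just r)) (_ , cₗ , cᵣ) all (fork1 ◂ q) with isLeaf b r in isLeafᵣ
... | false with w' , d , q' , d≢b , vars ← balanceRec-non-b b r cᵣ (Contracted-¬isLeaf r cᵣ isLeafᵣ) q =
  _ , d , fork1 ◂ q' , d≢b , cong (x ∷_) vars
... | true with _ , _ , q'' ← relabel-reaches⁻ b (balanceRec b l) q
           with w' , d , q' , d≢b , vars ←
                  balanceRec-non-b b l cₗ (∧-falseʳ (isLeaf⇒allLeaves b r isLeafᵣ) all) q'' =
  _ , d , fork0 ◂ q' , d≢b , cong (x ∷_) vars

balanceSide-leaf : ∀ b {l r : DT n} → isLeaf b l ≡ true → balanceSide b l r ≡ relabel b (balanceRec b r)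
balanceSide-leaf b e rewrite e = refl

balanceSide-¬leaf : ∀ b {l r : DT n} → isLeaf b l ≡ false → balanceSide b l r ≡ balanceRec b l
balanceSide-¬leaf b e rewrite e = refl

Child-unique : ∀ {t : DT n} {s u u'} → Child t s u → Child t s u' → u ≡ u'
Child-unique {s = s} k k' = Child-deterministic (λ _ → label s) k k' refl refl

data SameShape {n : ℕ} : DT n → DT n → Set where
  only0 : ∀ {x l₁ l₂}       → SameShape (node x (just l₁) nothing)   (node x (just l₂) nothing)
  only1 : ∀ {x r₁ r₂}       → SameShape (node x nothing (just r₁))   (node x nothing (just r₂))
  fork  : ∀ {x l₁ r₁ l₂ r₂} → SameShape (node x (just l₁) (just r₁)) (node x (just l₂) (just r₂))

Child-SameShape : ∀ {t₁ t₂ : DT n} {s u₁ u₂} → Child t₁ s u₁ → Child t₂ s u₂ → SameShape t₁ t₂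
Child-SameShape only0 only0 = only0
Child-SameShape only1 only1 = only1
Child-SameShape fork0 fork0 = fork
Child-SameShape fork1 fork1 = fork

AllVars : (Fin n → Set) → Walk n → Set
AllVars A = All (A ∘ var)

AllVars-map : ∀ {A : Fin n → Set} {w w'} → map var w' ≡ map var w → AllVars A w → AllVars A w'
AllVars-map {A = A} vars as = All.map⁻ (subst (All A) (sym vars) (All.map⁺ as))

module _ {n : ℕ} (A : Fin n → Set) (b : Bool) where

  record Refines (C₁ C₂ : DT n) : Set where
    field
      keeps-non-b : ∀ {w d} → Reaches C₁ w d → d ≢ b → AllVars A w → Reaches C₂ w d
      keeps-b     : ∀ {w₁ w₂ d} → Reaches C₁ w₁ b → AllVars A w₁ → Reaches C₂ (w₁ ++ w₂) d → d ≡ b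
  open Refines

  Refines-child : ∀ {C₁ C₂ s u₁ u₂} → Refines C₁ C₂ → A (var s) →
                  Child C₁ s u₁ → Child C₂ s u₂ → Refines u₁ u₂
  Refines-child ref a k₁ k₂ .keeps-non-b q d≢b as with k₂' ◂ q' ← keeps-non-b ref (k₁ ◂ q) d≢b (a ∷ as)
    rewrite Child-unique k₂ k₂' = q'
  Refines-child ref a k₁ k₂ .keeps-b q as q' = keeps-b ref (k₁ ◂ q) (a ∷ as) (k₂ ◂ q')

  Refines-b-leaf : ∀ {C₂} → Refines (leaf b) C₂ → Contracted b C₂ → C₂ ≡ leaf b
  Refines-b-leaf ref c₂ = Contracted-all-b _ c₂ (keeps-b ref end [])

  Refines-SameShape : ∀ {x m₀ m₁ C₂ w c} → Refines (node x m₀ m₁) C₂ → Contracted b (node x m₀ m₁) →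
                      Reaches (balanceRec b (node x m₀ m₁)) w c → AllVars A w → SameShape (node x m₀ m₁) C₂
  Refines-SameShape ref c₁ q as
    with _ , _ , k₁ ◂ q₁ , d≢b , vars ← balanceRec-non-b b _ c₁ (proj₁ c₁) q
    with k₂ ◂ _ ← keeps-non-b ref (k₁ ◂ q₁) d≢b (AllVars-map vars as) = Child-SameShape k₁ k₂

  mutual
    balanceRec-Refines : ∀ C₁ C₂ {w c} → Contracted b C₁ → Contracted b C₂ → Refines C₁ C₂ →
                         Reaches (balanceRec b C₁) w c → AllVars A w → Reaches (balanceRec b C₂) w c
    balanceRec-Refines (leaf c) C₂ _ c₂ ref end [] with c ≟B b
    ... | yes refl with refl ← Refines-b-leaf ref c₂ = end
    ... | no c≢b with end ← keeps-non-b ref end c≢b [] = end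
    balanceRec-Refines (node x m₀ m₁) C₂ c₁ c₂ ref q as =
      balanceRec-Refines-node x m₀ m₁ C₂ (Refines-SameShape ref c₁ q as) c₁ c₂ ref q as

    balanceRec-Refines-node : ∀ x m₀ m₁ C₂ {w c} → SameShape (node x m₀ m₁) C₂ →
                              Contracted b (node x m₀ m₁) → Contracted b C₂ → Refines (node x m₀ m₁) C₂ →
                              Reaches (balanceRec b (node x m₀ m₁)) w c → AllVars A w → Reaches (balanceRec b C₂) w c
    balanceRec-Refines-node x (just l₁) nothing (node _ (just l₂) nothing) only0
                            (_ , c₁ , _) (_ , c₂ , _) ref (only0 ◂ q) (a ∷ as) =
      only0 ◂ balanceRec-Refines l₁ l₂ c₁ c₂ (Refines-child ref a only0 only0) q as
    balanceRec-Refines-node x nothing (just r₁) (node _ nothing (just r₂)) only1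
                            (_ , _ , c₁) (_ , _ , c₂) ref (only1 ◂ q) (a ∷ as) =
      only1 ◂ balanceRec-Refines r₁ r₂ c₁ c₂ (Refines-child ref a only1 only1) q as
    balanceRec-Refines-node x (just l₁) (just r₁) (node _ (just l₂) (just r₂)) fork
                            (_ , cₗ₁ , cᵣ₁) (_ , cₗ₂ , cᵣ₂) ref (fork0 ◂ q) (a ∷ as) =
      fork0 ◂ balanceSide-Refines l₁ r₁ l₂ r₂ cₗ₁ cᵣ₁ cₗ₂ cᵣ₂
                (Refines-child ref a fork0 fork0) (Refines-child ref a fork1 fork1) q as
    balanceRec-Refines-node x (just l₁) (just r₁) (node _ (just l₂) (just r₂)) fork
                            (_ , cₗ₁ , cᵣ₁) (_ , cₗ₂ , cᵣ₂) ref (fork1 ◂ q) (a ∷ as) =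
      fork1 ◂ balanceSide-Refines r₁ l₁ r₂ l₂ cᵣ₁ cₗ₁ cᵣ₂ cₗ₂
                (Refines-child ref a fork1 fork1) (Refines-child ref a fork0 fork0) q as

    balanceSide-Refines : ∀ l₁ r₁ l₂ r₂ {w c} →
                          Contracted b l₁ → Contracted b r₁ → Contracted b l₂ → Contracted b r₂ →
                          Refines l₁ l₂ → Refines r₁ r₂ →
                          Reaches (balanceSide b l₁ r₁) w c → AllVars A w → Reaches (balanceSide b l₂ r₂) w c
    balanceSide-Refines l₁ r₁ l₂ r₂ cₗ₁ cᵣ₁ cₗ₂ cᵣ₂ refₗ refᵣ q as with isLeaf b l₁ in isLeafₗ₁
    ... | true with refl ← isLeaf-true b l₁ isLeafₗ₁
               with refl ← Refines-b-leaf refₗ cₗ₂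
               with refl , _ , q' ← relabel-reaches⁻ b (balanceRec b r₁) q
      = subst (λ t → Reaches t _ b) (sym (balanceSide-leaf b isLeafₗ₁))
              (relabel-reaches b (balanceRec-Refines r₁ r₂ cᵣ₁ cᵣ₂ refᵣ q' as))
    ... | false with _ , _ , q' , d≢b , vars ← balanceRec-non-b b l₁ cₗ₁ (Contracted-¬isLeaf l₁ cₗ₁ isLeafₗ₁) q
      = subst (λ t → Reaches t _ _)
              (sym (balanceSide-¬leaf b (reaches-¬isLeaf b (keeps-non-b refₗ q' d≢b (AllVars-map vars as)) d≢b)))
              (balanceRec-Refines l₁ l₂ cₗ₁ cₗ₂ refₗ q as)

data Reshaped {n : ℕ} : DT n → DT n → Set where
  base        : ∀ {t} → Reshaped t t
  _∘applyR_     : ∀ {t t'} → Reshaped t t' → ∀ σ → Reshaped t (applyR σ t')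
  _∘relabel_    : ∀ {t t'} → Reshaped t t' → ∀ b → Reshaped t (relabel b t')
  _∘contract_   : ∀ {t t'} → Reshaped t t' → ∀ b → Reshaped t (contract b t')
  _∘balanceRec_ : ∀ {t t'} → Reshaped t t' → ∀ b → Reshaped t (balanceRec b t')

Reshaped-child : ∀ {t t' : DT n} {s' u'} → Reshaped t t' → Child t' s' u' →
                 ∃₂ λ s u → Child t s u × var s ≡ var s' × Reshaped u u'
Reshaped-child base k = _ , _ , k , refl , base
Reshaped-child (_∘applyR_ {t' = t'} rs σ) k
  with s , u , k' , p , refl ← applyR-child⁻ σ t' k
  with s° , u° , k° , v≡ , rs' ← Reshaped-child rs k' = s° , u° , k° , trans v≡ (PrunedStep-var p) , rs' ∘applyR σ
Reshaped-child (_∘relabel_ {t' = t'} rs b) k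
  with u , k' , refl ← relabel-child⁻ b t' k
  with s° , u° , k° , v≡ , rs' ← Reshaped-child rs k' = s° , u° , k° , v≡ , rs' ∘relabel b
Reshaped-child (_∘contract_ {t' = t'} rs b) k with contract b t' | contract-view b t'
... | _ | kept _
  with u , k' , refl ← contract-child⁻ b t' k
  with s° , u° , k° , v≡ , rs' ← Reshaped-child rs k' = s° , u° , k° , v≡ , rs' ∘contract b
Reshaped-child (_∘balanceRec_ {t' = t'} rs b) k
  with s , u , k' , v≡ , u'≡ ← balanceRec-child⁻ b t' k
  with s° , u° , k° , v≡° , rs' ← Reshaped-child rs k' = s° , u° , k° , trans v≡° v≡ , reshaped u'≡ rs'
  where
  reshaped : ∀ {u' u°} → u' ≡ balanceRec b u ⊎ u' ≡ relabel b (balanceRec b u) → Reshaped u° u → Reshaped u° u'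
  reshaped (inj₁ refl) rs' = rs' ∘balanceRec b
  reshaped (inj₂ refl) rs' = (rs' ∘balanceRec b) ∘relabel b

Reshaped-queries : ∀ {t t' : DT n} {v} → Reshaped t t' → Queries v t' → Queries v t
Reshaped-queries rs (here k e) with _ , _ , k° , v≡ , _ ← Reshaped-child rs k = here k° (trans v≡ e)
Reshaped-queries rs (there k q) with _ , _ , k° , _ , rs' ← Reshaped-child rs k = there k° (Reshaped-queries rs' q)

Reshaped-repetitionFree : ∀ {t t' : DT n} → Reshaped t t' → RepetitionFree t → RepetitionFree t'
Reshaped-repetitionFree rs (repetitionFree rf) = repetitionFree fresh
  where
  fresh : ∀ {s' u'} → Child _ s' u' → ¬ Queries (var s') u' × RepetitionFree u'
  fresh k with _ , u° , k° , refl , rs' ← Reshaped-child rs k with ¬q , rfᵤ ← rf k° =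
    ¬q ∘ Reshaped-queries rs' , Reshaped-repetitionFree rs' rfᵤ

data IsGate {n : ℕ} : Bool → Formula n → List (Formula n) → Set where
  or-gate  : ∀ {Gs} → IsGate false (or Gs) Gs
  and-gate : ∀ {Gs} → IsGate true (and Gs) Gs

gate-IsGate : ∀ b (Fs : List (Formula n)) → IsGate b (gate b Fs) Fs
gate-IsGate false _ = or-gate
gate-IsGate true  _ = and-gate

restrictF-IsGate : ∀ {b G Gs} (σ : Restriction n) → IsGate b G Gs → IsGate b (restrictF G σ) (restrictFs Gs σ)
restrictF-IsGate σ or-gate  = or-gate
restrictF-IsGate σ and-gate = and-gate

mutual
  ValidPos-restrictF : ∀ {σ : Restriction n} (G : Formula n) {p} → ValidPos (restrictF G σ) p → ValidPos G p
  ValidPos-restrictF (const _) here = here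
  ValidPos-restrictF {σ = σ} (lit _ v) q with σ v
  ValidPos-restrictF (lit _ v) here | just _  = here
  ValidPos-restrictF (lit _ v) here | nothing = here
  ValidPos-restrictF (or _)  here = here
  ValidPos-restrictF (and _) here = here
  ValidPos-restrictF (or Fs) (inOr i q) with j , e , q' ← ValidPos-restrictFs Fs i q rewrite e = inOr j q'
  ValidPos-restrictF (and Fs) (inAnd i q) with j , e , q' ← ValidPos-restrictFs Fs i q rewrite e = inAnd j q'

  ValidPos-restrictFs : ∀ {σ : Restriction n} (Fs : List (Formula n)) {p} (i : Fin (length (restrictFs Fs σ))) →
                        ValidPos (lookup (restrictFs Fs σ) i) p → ∃ λ j → toℕ i ≡ toℕ j × ValidPos (lookup Fs j) p
  ValidPos-restrictFs (F ∷ Fs) fzero q = fzero , refl , ValidPos-restrictF F q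
  ValidPos-restrictFs (F ∷ Fs) (fsuc i) q with j , e , q' ← ValidPos-restrictFs Fs i q = fsuc j , cong suc e , q'

IsRestrTree-restrictF : ∀ {σ : Restriction n} (G : Formula n) {ρ̃} → IsRestrTree G ρ̃ → IsRestrTree (restrictF G σ) ρ̃
IsRestrTree-restrictF G rt p q v = rt p q (ValidPos-restrictF G v)

ValidPos-child : ∀ {b G Gs} → IsGate {n} b G Gs → ∀ i {q} →
                 ValidPos (lookup Gs i) q → ValidPos G (toℕ i ∷ q)
ValidPos-child or-gate  i = inOr i
ValidPos-child and-gate i = inAnd i

IsRestrTree-child : ∀ {b G Gs ρ̃} → IsGate {n} b G Gs → IsRestrTree G ρ̃ → (i : Fin (length Gs)) →
                    IsRestrTree (lookup Gs i) (childRT ρ̃ (toℕ i))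
IsRestrTree-child g rt i p q v = rt (toℕ i ∷ p) q (ValidPos-child g i v)

IsRestrTree-root : ∀ {b G Gs ρ̃} → IsGate {n} b G Gs → IsRestrTree G ρ̃ → (i : Fin (length Gs)) →
                   ρ̃ [] ≼ childRT ρ̃ (toℕ i) []
IsRestrTree-root g rt i = rt [] (toℕ i ∷ []) (ValidPos-child g i here)

NotGate : Bool → Formula n → Set
NotGate false = NotOr
NotGate true  = NotAnd

mutual
  WF-restrictF : ∀ {σ : Restriction n} {G : Formula n} → WF G → WF (restrictF G σ)
  WF-restrictF (wf-const c) = wf-const c
  WF-restrictF {σ = σ} (wf-lit p v) with σ v
  ... | just _  = wf-const _
  ... | nothing = wf-lit p v
  WF-restrictF (wf-or ws)  = wf-or (WF-restrictFs false ws)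
  WF-restrictF (wf-and ws) = wf-and (WF-restrictFs true ws)

  WF-restrictFs : ∀ {σ : Restriction n} b {Fs : List (Formula n)} →
                  All (λ G → NotGate b G × WF G) Fs → All (λ G → NotGate b G × WF G) (restrictFs Fs σ)
  WF-restrictFs b []              = []
  WF-restrictFs b ((ng , w) ∷ ws) = (NotGate-restrictF b _ ng , WF-restrictF w) ∷ WF-restrictFs b ws

  NotGate-restrictF : ∀ {σ : Restriction n} b (H : Formula n) → NotGate b H → NotGate b (restrictF H σ)
  NotGate-restrictF b (const _) ng = ng
  NotGate-restrictF {σ = σ} b (lit _ v) ng with σ v
  NotGate-restrictF false (lit _ v) ng | just _  = tt
  NotGate-restrictF true  (lit _ v) ng | just _  = tt
  ... | nothing = ng
  NotGate-restrictF false (and _) ng = tt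
  NotGate-restrictF true  (or _)  ng = tt

WF-child : ∀ {b G Gs} → IsGate {n} b G Gs → WF G → (i : Fin (length Gs)) → NotGate b (lookup Gs i) × WF (lookup Gs i)
WF-child or-gate  (wf-or ws)  i = All.lookup ws (∈-lookup i)
WF-child and-gate (wf-and ws) i = All.lookup ws (∈-lookup i)

data Mentions {n : ℕ} (v : Fin n) : Formula n → Set where
  in-lit : ∀ {p} → Mentions v (lit p v)
  in-or  : ∀ {Fs} → Any (Mentions v) Fs → Mentions v (or Fs)
  in-and : ∀ {Fs} → Any (Mentions v) Fs → Mentions v (and Fs)

mutual
  Mentions-restrictF⁻ : ∀ {σ : Restriction n} {v} (G : Formula n) → Mentions v (restrictF G σ) →
                        Mentions v G × σ v ≡ nothing
  Mentions-restrictF⁻ {σ = σ} (lit p w) m with σ w in σw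
  Mentions-restrictF⁻ (lit p w) in-lit | nothing = in-lit , σw
  Mentions-restrictF⁻ (or Fs)  (in-or ms)  = map₁ in-or (Mentions-restrictFs⁻ Fs ms)
  Mentions-restrictF⁻ (and Fs) (in-and ms) = map₁ in-and (Mentions-restrictFs⁻ Fs ms)

  Mentions-restrictFs⁻ : ∀ {σ : Restriction n} {v} (Fs : List (Formula n)) →
                         Any (Mentions v) (restrictFs Fs σ) → Any (Mentions v) Fs × σ v ≡ nothing
  Mentions-restrictFs⁻ (F ∷ Fs) (here m)   = map₁ here (Mentions-restrictF⁻ F m)
  Mentions-restrictFs⁻ (F ∷ Fs) (there ms) = map₁ there (Mentions-restrictFs⁻ Fs ms)

Mentions-child : ∀ {b G Gs} {v : Fin n} → IsGate b G Gs → ∀ i → Mentions v (lookup Gs i) → Mentions v G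
Mentions-child or-gate  i m = in-or (lose (∈-lookup i) m)
Mentions-child and-gate i m = in-and (lose (∈-lookup i) m)

FollowsR : (Fin n → Bool) → OrdRestr n → Set
FollowsR x = All (λ (v , c) → x v ≡ c)

Extends-toRestr : ∀ {x : Fin n → Bool} α → FollowsR x α → Extends x (toRestr α)
Extends-toRestr ((v , c) ∷ α) (e ∷ es) u d eq with v ≟ u
Extends-toRestr ((v , c) ∷ α) (e ∷ es) .v .c refl | yes refl = e
... | no _ = Extends-toRestr α es u d eq

toRestr-∷ʳ-free : ∀ (α : OrdRestr n) vc u → toRestr (α ∷ʳ vc) u ≡ nothing → toRestr α u ≡ nothing
toRestr-∷ʳ-free [] vc u _ = refl
toRestr-∷ʳ-free ((v , c) ∷ α) vc u e with does (v ≟ u)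
... | false = toRestr-∷ʳ-free α vc u e

toRestr-∷ʳ-fixed : ∀ (α : OrdRestr n) v c → toRestr (α ∷ʳ (v , c)) v ≢ nothing
toRestr-∷ʳ-fixed [] v c e with v ≟ v
... | no v≢v = v≢v refl
toRestr-∷ʳ-fixed ((u , d) ∷ α) v c e with does (u ≟ v)
... | false = toRestr-∷ʳ-fixed α v c e

eval-gate-all : ∀ {b G Gs} {x : Fin n → Bool} → IsGate b G Gs → (∀ i → eval (lookup Gs i) x ≡ b) → eval G x ≡ b
eval-gate-all {Gs = Gs} {x} or-gate = go Gs
  where
  go : ∀ Fs → (∀ i → eval (lookup Fs i) x ≡ false) → evalOr Fs x ≡ false
  go []       _ = refl
  go (F ∷ Fs) h rewrite h fzero = go Fs (h ∘ fsuc)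
eval-gate-all {Gs = Gs} {x} and-gate = go Gs
  where
  go : ∀ Fs → (∀ i → eval (lookup Fs i) x ≡ true) → evalAnd Fs x ≡ true
  go []       _ = refl
  go (F ∷ Fs) h rewrite h fzero = go Fs (h ∘ fsuc)

eval-gate-some : ∀ {b G Gs} {x : Fin n → Bool} → IsGate b G Gs → ∀ i → eval (lookup Gs i) x ≡ not b → eval G x ≡ not b
eval-gate-some {Gs = Gs} {x} or-gate = go Gs
  where
  go : ∀ Fs i → eval (lookup Fs i) x ≡ true → evalOr Fs x ≡ true
  go (F ∷ Fs) fzero e rewrite e = refl
  go (F ∷ Fs) (fsuc i) e with eval F x
  ... | true  = refl
  ... | false = go Fs i e
eval-gate-some {Gs = Gs} {x} and-gate = go Gs
  where
  go : ∀ Fs i → eval (lookup Fs i) x ≡ false → evalAnd Fs x ≡ false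
  go (F ∷ Fs) fzero e rewrite e = refl
  go (F ∷ Fs) (fsuc i) e with eval F x
  ... | true  = go Fs i e
  ... | false = refl

CDTAt : Formula n → RTree n → OrdRestr n → DT n → Set
CDTAt G ρ̃ α = IsCDT (restrictF G (toRestr α)) ρ̃

-- Canonical decision trees

-- Γ'' of the definition of CDT(F, ρ̃), before the CDTs are grafted on.
recTree : Bool → Restriction n → DT n → DT n
recTree b σ Γ = balance b (applyR σ Γ)

recTree-Reshaped : ∀ b σ (Γ : DT n) → Reshaped Γ (recTree b σ Γ)
recTree-Reshaped b σ Γ rewrite balance≡balanceRec∘contract b (applyR σ Γ) =
  ((base ∘applyR σ) ∘contract b) ∘balanceRec b

recTree-⇓ : ∀ b {σ σ₀ : Restriction n} Γ {x c} → σ ≼ σ₀ → Fits σ₀ Γ → Extends x σ →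
            x ⊢ Γ ⇓ c → x ⊢ recTree b σ Γ ⇓ c
recTree-⇓ b {σ} Γ σ≼σ₀ fits x⊨σ p rewrite balance≡balanceRec∘contract b (applyR σ Γ) =
  balanceRec-⇓ b _ (contract-Fits b _ (applyR-Fits Γ σ≼σ₀ fits)) x⊨σ (contract-⇓ b (applyR-⇓ σ x⊨σ p))

mutual
  cdt-Fits : ∀ {F : Formula n} {ρ̃ Γ} → IsRestrTree F ρ̃ → IsCDT F ρ̃ Γ → Fits (ρ̃ []) Γ
  cdt-Fits rt (cdt-const _)                = tt
  cdt-Fits rt (cdt-lit-fixed _)            = tt
  cdt-Fits rt (cdt-lit-free e)             = (inj₁ e , tt) , (inj₁ e , tt)
  cdt-Fits rt (cdt-or-0 _)                 = tt
  cdt-Fits rt (cdt-or-1 _ _ _)             = tt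
  cdt-Fits rt (cdt-or-rec ℓ _ _ _ ch gr)   = graft-Fits _ rt gr (recTree-Fits or-gate rt ℓ ch)
  cdt-Fits rt (cdt-and-1 _)                = tt
  cdt-Fits rt (cdt-and-0 _ _ _)            = tt
  cdt-Fits rt (cdt-and-rec ℓ _ _ _ ch gr)  = graft-Fits _ rt gr (recTree-Fits and-gate rt ℓ ch)

  recTree-Fits : ∀ {b G Gs ρ̃ Γ} → IsGate {n} b G Gs → IsRestrTree G ρ̃ → ∀ ℓ →
                 IsCDT (lookup Gs ℓ) (childRT ρ̃ (toℕ ℓ)) Γ → Fits (ρ̃ []) (recTree b (ρ̃ []) Γ)
  recTree-Fits {b = b} {ρ̃ = ρ̃} {Γ} g rt ℓ ch rewrite balance≡balanceRec∘contract b (applyR (ρ̃ []) Γ) =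
    balanceRec-Fits b _ (contract-Fits b _
      (applyR-Fits Γ (IsRestrTree-root g rt ℓ) (cdt-Fits (IsRestrTree-child g rt ℓ) ch)))

  graft-Fits : ∀ (G : Formula n) {ρ̃ b α t t'} → IsRestrTree G ρ̃ → Graft (CDTAt G ρ̃) b α t t' →
               Fits (ρ̃ []) t → Fits (ρ̃ []) t'
  graft-Fits G rt (g-leafb r)   _          = cdt-Fits (IsRestrTree-restrictF G rt) r
  graft-Fits G rt (g-leafo _)   _          = tt
  graft-Fits G rt (g-node g₀ g₁) (e₀ , e₁) = graftM-FitsEdge G rt g₀ e₀ , graftM-FitsEdge G rt g₁ e₁

  graftM-FitsEdge : ∀ (G : Formula n) {ρ̃ b α m m' v c} → IsRestrTree G ρ̃ → GraftM (CDTAt G ρ̃) b α m m' →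
                    FitsEdge (ρ̃ []) v c m → FitsEdge (ρ̃ []) v c m'
  graftM-FitsEdge G rt g-nothing  e            = e
  graftM-FitsEdge G rt (g-just g) (perm , fits) = perm , graft-Fits G rt g fits

mutual
  cdt-⇓ : ∀ {F : Formula n} {ρ̃ Γ x} → IsRestrTree F ρ̃ → IsCDT F ρ̃ Γ → Extends x (ρ̃ []) → x ⊢ Γ ⇓ eval F x
  cdt-⇓ rt (cdt-const _) _ = end
  cdt-⇓ rt (cdt-lit-fixed {x = v} {b = d} e) x⊨ rewrite x⊨ v d e = end
  cdt-⇓ {x = x} rt (cdt-lit-free {x = v} e) _ with x v in xv
  ... | false = step fork0 xv end
  ... | true  = step fork1 xv end
  cdt-⇓ rt (cdt-or-0 {Fs = Fs} h) x⊨ =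
    ⇓-leaf (sym (eval-gate-all {Gs = Fs} or-gate (λ i → RestrictsTo-elim (lookup Fs i) (h i) x⊨)))
  cdt-⇓ rt (cdt-or-1 {Fs = Fs} ℓ _ h) x⊨ =
    ⇓-leaf (sym (eval-gate-some {Gs = Fs} or-gate ℓ (RestrictsTo-elim (lookup Fs ℓ) h x⊨)))
  cdt-⇓ rt (cdt-or-rec ℓ _ _ _ ch gr) x⊨ = recursive-⇓ or-gate rt ℓ ch gr x⊨
  cdt-⇓ rt (cdt-and-1 {Fs = Fs} h) x⊨ =
    ⇓-leaf (sym (eval-gate-all {Gs = Fs} and-gate (λ i → RestrictsTo-elim (lookup Fs i) (h i) x⊨)))
  cdt-⇓ rt (cdt-and-0 {Fs = Fs} ℓ _ h) x⊨ =
    ⇓-leaf (sym (eval-gate-some {Gs = Fs} and-gate ℓ (RestrictsTo-elim (lookup Fs ℓ) h x⊨)))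
  cdt-⇓ rt (cdt-and-rec ℓ _ _ _ ch gr) x⊨ = recursive-⇓ and-gate rt ℓ ch gr x⊨

  recursive-⇓ : ∀ {b G Gs ρ̃ Γ Γ' x} → IsGate {n} b G Gs → IsRestrTree G ρ̃ → ∀ ℓ →
                IsCDT (lookup Gs ℓ) (childRT ρ̃ (toℕ ℓ)) Γ → Graft (CDTAt G ρ̃) b [] (recTree b (ρ̃ []) Γ) Γ' →
                Extends x (ρ̃ []) → x ⊢ Γ' ⇓ eval G x
  recursive-⇓ {b = b} {G} {Γ = Γ} g rt ℓ ch gr x⊨ =
    graft-⇓ G rt gr [] x⊨ (recTree-⇓ b Γ root (cdt-Fits rtℓ ch) x⊨ (cdt-⇓ rtℓ ch (Extends-≼ root x⊨)))
      (λ c≢b → trans (¬-not c≢b) (sym (eval-gate-some g ℓ (¬-not c≢b))))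
    where
    rtℓ  = IsRestrTree-child g rt ℓ
    root = IsRestrTree-root g rt ℓ

  graft-⇓ : ∀ (G : Formula n) {ρ̃ b α t t' x c} → IsRestrTree G ρ̃ → Graft (CDTAt G ρ̃) b α t t' →
            FollowsR x α → Extends x (ρ̃ []) → x ⊢ t ⇓ c → (c ≢ b → c ≡ eval G x) → x ⊢ t' ⇓ eval G x
  graft-⇓ G {α = α} rt (g-leafb r) f x⊨ end _ =
    subst (_ ⊢ _ ⇓_) (eval-restrictF-extends G (Extends-toRestr α f)) (cdt-⇓ (IsRestrTree-restrictF G rt) r x⊨)
  graft-⇓ G rt (g-leafo c≢b) f x⊨ end h rewrite h c≢b = end
  graft-⇓ G rt (g-node (g-just g₀) g-nothing) f x⊨ (step only0 e p) h =
    step only0 e (graft-⇓ G rt g₀ (All.∷ʳ⁺ f e) x⊨ p h)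
  graft-⇓ G rt (g-node g-nothing (g-just g₁)) f x⊨ (step only1 e p) h =
    step only1 e (graft-⇓ G rt g₁ (All.∷ʳ⁺ f e) x⊨ p h)
  graft-⇓ G rt (g-node (g-just g₀) (g-just _)) f x⊨ (step fork0 e p) h =
    step fork0 e (graft-⇓ G rt g₀ (All.∷ʳ⁺ f e) x⊨ p h)
  graft-⇓ G rt (g-node (g-just _) (g-just g₁)) f x⊨ (step fork1 e p) h =
    step fork1 e (graft-⇓ G rt g₁ (All.∷ʳ⁺ f e) x⊨ p h)

¬Queries-leaf : ∀ {v : Fin n} {c} → ¬ Queries v (leaf c)
¬Queries-leaf (here () _)
¬Queries-leaf (there () _)

leaf-RepetitionFree : ∀ {c} → RepetitionFree {n} (leaf c)
leaf-RepetitionFree = repetitionFree λ ()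

GraftM-child⁻ : ∀ {R : OrdRestr n → DT n → Set} {b α x m₀ m₁ m₀' m₁' s u'} →
                GraftM R b (α ∷ʳ (x , false)) m₀ m₀' → GraftM R b (α ∷ʳ (x , true)) m₁ m₁' →
                Child (node x m₀' m₁') s u' →
                ∃ λ u → Child (node x m₀ m₁) s u × Graft R b (α ∷ʳ (var s , label s)) u u'
GraftM-child⁻ (g-just g₀) g-nothing  only0 = _ , only0 , g₀
GraftM-child⁻ g-nothing  (g-just g₁) only1 = _ , only1 , g₁
GraftM-child⁻ (g-just g₀) (g-just _) fork0 = _ , fork0 , g₀
GraftM-child⁻ (g-just _) (g-just g₁) fork1 = _ , fork1 , g₁

module _ {v : Fin n} where

  -- A variable queried in a grafted tree is queried in the tree grafted onto, or
  -- by a CDT of G restricted by α, hence mentioned in G and outside Dom(α).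
  QueriedOrFresh : Formula n → OrdRestr n → DT n → Set
  QueriedOrFresh G α t = Queries v t ⊎ (Mentions v G × toRestr α v ≡ nothing)

  descend : ∀ {G} α {t s u} → Child t s u → QueriedOrFresh G (α ∷ʳ (var s , label s)) u → QueriedOrFresh G α t
  descend α k (inj₁ q)       = inj₁ (there k q)
  descend α k (inj₂ (m , e)) = inj₂ (m , toRestr-∷ʳ-free α _ v e)

  mutual
    cdt-queries : ∀ {F : Formula n} {ρ̃ Γ} → IsCDT F ρ̃ Γ → Queries v Γ → Mentions v F
    cdt-queries (cdt-lit-free _) (here fork0 refl) = in-lit
    cdt-queries (cdt-lit-free _) (here fork1 refl) = in-lit
    cdt-queries (cdt-lit-free _) (there fork0 q) = ⊥-elim (¬Queries-leaf q)
    cdt-queries (cdt-lit-free _) (there fork1 q) = ⊥-elim (¬Queries-leaf q)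
    cdt-queries (cdt-or-rec ℓ _ _ _ ch gr)  q = recursive-queries or-gate ℓ ch gr q
    cdt-queries (cdt-and-rec ℓ _ _ _ ch gr) q = recursive-queries and-gate ℓ ch gr q
    cdt-queries (cdt-const _)       q = ⊥-elim (¬Queries-leaf q)
    cdt-queries (cdt-lit-fixed _)   q = ⊥-elim (¬Queries-leaf q)
    cdt-queries (cdt-or-0 _)        q = ⊥-elim (¬Queries-leaf q)
    cdt-queries (cdt-or-1 _ _ _)    q = ⊥-elim (¬Queries-leaf q)
    cdt-queries (cdt-and-1 _)       q = ⊥-elim (¬Queries-leaf q)
    cdt-queries (cdt-and-0 _ _ _)   q = ⊥-elim (¬Queries-leaf q)

    recursive-queries : ∀ {b G Gs ρ̃ Γ Γ'} → IsGate b G Gs → ∀ ℓ → IsCDT (lookup Gs ℓ) (childRT ρ̃ (toℕ ℓ)) Γ →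
                        Graft (CDTAt G ρ̃) b [] (recTree b (ρ̃ []) Γ) Γ' → Queries v Γ' → Mentions v G
    recursive-queries g ℓ ch gr q with graft-queries gr q
    ... | inj₁ q'      = Mentions-child g ℓ (cdt-queries ch (Reshaped-queries (recTree-Reshaped _ _ _) q'))
    ... | inj₂ (m , _) = m

    graft-queries : ∀ {G ρ̃ b α t t'} → Graft (CDTAt G ρ̃) b α t t' → Queries v t' → QueriedOrFresh G α t
    graft-queries {G} (g-leafb r) q = inj₂ (Mentions-restrictF⁻ G (cdt-queries r q))
    graft-queries (g-leafo _) q = ⊥-elim (¬Queries-leaf q)
    graft-queries (g-node g₀ g₁) (here k e) with _ , k° , _ ← GraftM-child⁻ g₀ g₁ k = inj₁ (here k° e)
    graft-queries {α = α} (g-node (g-just g₀) g-nothing)  (there only0 q) = descend α only0 (graft-queries g₀ q)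
    graft-queries {α = α} (g-node g-nothing (g-just g₁))  (there only1 q) = descend α only1 (graft-queries g₁ q)
    graft-queries {α = α} (g-node (g-just g₀) (g-just _)) (there fork0 q) = descend α fork0 (graft-queries g₀ q)
    graft-queries {α = α} (g-node (g-just _) (g-just g₁)) (there fork1 q) = descend α fork1 (graft-queries g₁ q)

mutual
  cdt-RepetitionFree : ∀ {F : Formula n} {ρ̃ Γ} → IsCDT F ρ̃ Γ → RepetitionFree Γ
  cdt-RepetitionFree (cdt-lit-free _) = repetitionFree λ { fork0 → ¬Queries-leaf , leaf-RepetitionFree
                                                         ; fork1 → ¬Queries-leaf , leaf-RepetitionFree }
  cdt-RepetitionFree (cdt-or-rec {Fs = Fs} _ _ _ _ ch gr)  = graft-RepetitionFree (or Fs) gr (recTree-RepetitionFree ch)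
  cdt-RepetitionFree (cdt-and-rec {Fs = Fs} _ _ _ _ ch gr) = graft-RepetitionFree (and Fs) gr (recTree-RepetitionFree ch)
  cdt-RepetitionFree (cdt-const _)     = leaf-RepetitionFree
  cdt-RepetitionFree (cdt-lit-fixed _) = leaf-RepetitionFree
  cdt-RepetitionFree (cdt-or-0 _)      = leaf-RepetitionFree
  cdt-RepetitionFree (cdt-or-1 _ _ _)  = leaf-RepetitionFree
  cdt-RepetitionFree (cdt-and-1 _)     = leaf-RepetitionFree
  cdt-RepetitionFree (cdt-and-0 _ _ _) = leaf-RepetitionFree

  recTree-RepetitionFree : ∀ {F : Formula n} {ρ̃ Γ b σ} → IsCDT F ρ̃ Γ → RepetitionFree (recTree b σ Γ)
  recTree-RepetitionFree ch = Reshaped-repetitionFree (recTree-Reshaped _ _ _) (cdt-RepetitionFree ch)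

  graft-RepetitionFree : ∀ (G : Formula n) {ρ̃ b α t t'} → Graft (CDTAt G ρ̃) b α t t' →
                         RepetitionFree t → RepetitionFree t'
  graft-RepetitionFree G (g-leafb r)    _                   = cdt-RepetitionFree r
  graft-RepetitionFree G (g-leafo _)    _                   = leaf-RepetitionFree
  graft-RepetitionFree G (g-node g₀ g₁) (repetitionFree rf) = repetitionFree (graft-children G g₀ g₁ rf)

  graft-children : ∀ (G : Formula n) {ρ̃ b α x m₀ m₁ m₀' m₁'} →
                   GraftM (CDTAt G ρ̃) b (α ∷ʳ (x , false)) m₀ m₀' →
                   GraftM (CDTAt G ρ̃) b (α ∷ʳ (x , true)) m₁ m₁' →
                   (∀ {s u} → Child (node x m₀ m₁) s u → ¬ Queries (var s) u × RepetitionFree u) →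
                   ∀ {s u'} → Child (node x m₀' m₁') s u' → ¬ Queries (var s) u' × RepetitionFree u'
  graft-children G (g-just g₀) g-nothing  rf only0 = graft-child G g₀ (rf only0)
  graft-children G g-nothing  (g-just g₁) rf only1 = graft-child G g₁ (rf only1)
  graft-children G (g-just g₀) (g-just _) rf fork0 = graft-child G g₀ (rf fork0)
  graft-children G (g-just _) (g-just g₁) rf fork1 = graft-child G g₁ (rf fork1)

  -- x is fixed by α ∷ʳ (x , c), so the grafted CDTs below do not query it.
  graft-child : ∀ (G : Formula n) {ρ̃ b α x c u u'} → Graft (CDTAt G ρ̃) b (α ∷ʳ (x , c)) u u' →
                ¬ Queries x u × RepetitionFree u → ¬ Queries x u' × RepetitionFree u'
  graft-child G {α = α} {x} {c} g (¬q , rfᵤ) =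
    [ ¬q , (λ (_ , x-free) → toRestr-∷ʳ-fixed α x c x-free) ]′ ∘ graft-queries {G = G} g , graft-RepetitionFree G g rfᵤ

record Represents (F : Formula n) (σ : Restriction n) (C : DT n) : Set where
  field
    fits       : Fits σ C
    no-repeats : RepetitionFree C
    computes   : ∀ {x} → Extends x σ → x ⊢ C ⇓ eval F x
open Represents

cdt-Represents : ∀ {F : Formula n} {ρ̃ Γ} → IsRestrTree F ρ̃ → IsCDT F ρ̃ Γ → Represents F (ρ̃ []) Γ
cdt-Represents rt ch = record { fits = cdt-Fits rt ch ; no-repeats = cdt-RepetitionFree ch ; computes = cdt-⇓ rt ch }

contract-applyR-Represents : ∀ b {F : Formula n} {σ σ₀ Γ} → σ ≼ σ₀ → Represents F σ₀ Γ →
                             Represents F σ (contract b (applyR σ Γ))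
contract-applyR-Represents b {σ = σ} {Γ = Γ} σ≼σ₀ rep = record
  { fits       = contract-Fits b _ (applyR-Fits Γ σ≼σ₀ (fits rep))
  ; no-repeats = Reshaped-repetitionFree ((base ∘applyR σ) ∘contract b) (no-repeats rep)
  ; computes   = λ x⊨σ → contract-⇓ b (applyR-⇓ σ x⊨σ (computes rep (Extends-≼ σ≼σ₀ x⊨σ)))
  }

Represents-realize : ∀ {F : Formula n} {σ σ' C w d} → Represents F σ C → σ' ≼ σ → ConsistentWalk σ' w →
                     Reaches C w d → ∃ λ x → Extends x σ' × eval F x ≡ d
Represents-realize {σ' = σ'} {w = w} rep σ'≼σ cons r
  with x , follows , x⊨σ' ← witness σ' w (RepetitionFree-distinct (no-repeats rep) r) cons =
  x , x⊨σ' , ⇓-functional (computes rep (Extends-≼ σ'≼σ x⊨σ')) (Reaches⇒⇓ r follows)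

Represents-¬RestrictsTo : ∀ {F : Formula n} {σ σ' C w d c} → Represents F σ C → σ' ≼ σ → ConsistentWalk σ' w →
                          Reaches C w d → d ≢ c → ¬ RestrictsTo F σ' c
Represents-¬RestrictsTo {F = F} rep σ'≼σ cons r d≢c F|σ'≡c
  with x , x⊨σ' , eval≡d ← Represents-realize rep σ'≼σ cons r =
  d≢c (trans (sym eval≡d) (RestrictsTo-elim F F|σ'≡c x⊨σ'))

-- An input extending σ' that follows w₁ ++ w₂ in C₂ also follows w₁ in C₁, and
-- both trees output F of it.
Represents-keeps-b : ∀ {F : Formula n} {σ σ' C₁ C₂ w₁ w₂ b d} →
                     Represents F σ C₁ → Represents F σ' C₂ → σ' ≼ σ →
                     Reaches C₁ w₁ b → Reaches C₂ (w₁ ++ w₂) d → d ≡ b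
Represents-keeps-b {σ' = σ'} {w₁ = w₁} {w₂} rep₁ rep₂ σ'≼σ r₁ r₂
  with x , follows , x⊨σ' ← witness σ' (w₁ ++ w₂) (RepetitionFree-distinct (no-repeats rep₂) r₂)
                                                   (Fits-consistent (fits rep₂) r₂) =
  trans (⇓-functional (Reaches⇒⇓ r₂ follows) (computes rep₂ x⊨σ'))
        (⇓-functional (computes rep₁ (Extends-≼ σ'≼σ x⊨σ')) (Reaches⇒⇓ r₁ (All.++⁻ˡ w₁ follows)))

ConsistentWalk-agree : ∀ {A : Fin n → Set} {σ σ' w} → (∀ v → A v → σ' v ≡ σ v) → AllVars A w →
                       ConsistentWalk σ w → ConsistentWalk σ' w
ConsistentWalk-agree agree []       []                = []
ConsistentWalk-agree agree (a ∷ as) (inj₁ e ∷ perms) = inj₁ (trans (agree _ a) e) ∷ ConsistentWalk-agree agree as perms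
ConsistentWalk-agree agree (a ∷ as) (inj₂ e ∷ perms) = inj₂ (trans (agree _ a) e) ∷ ConsistentWalk-agree agree as perms

Pruned-agree : ∀ {A : Fin n → Set} {σ σ' w w'} → (∀ v → A v → σ' v ≡ σ v) → AllVars A w' →
               Pruned σ w w' → Pruned σ' w w'
Pruned-agree agree []       []              = []
Pruned-agree agree (a ∷ as) (free e  ∷ ps) = free (trans (agree _ a) e) ∷ Pruned-agree agree as ps
Pruned-agree agree (a ∷ as) (fixed e ∷ ps) = fixed (trans (agree _ a) e) ∷ Pruned-agree agree as ps

Pruned-AllVars : ∀ {A : Fin n → Set} {σ w w'} → Pruned σ w w' → AllVars A w' → AllVars A w
Pruned-AllVars []             []       = []
Pruned-AllVars (free _  ∷ ps) (a ∷ as) = a ∷ Pruned-AllVars ps as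
Pruned-AllVars (fixed _ ∷ ps) (a ∷ as) = a ∷ Pruned-AllVars ps as

AllBefore : Bool → (Gs : List (Formula n)) → Restriction n → Fin (length Gs) → Set
AllBefore b Gs σ ℓ = ∀ i → toℕ i < toℕ ℓ → RestrictsTo (lookup Gs i) σ b

data CDTView {n : ℕ} (b : Bool) (G : Formula n) (Gs : List (Formula n)) (ρ̃ : RTree n) : DT n → Set where
  all-b   : (∀ i → RestrictsTo (lookup Gs i) (ρ̃ []) b) → CDTView b G Gs ρ̃ (leaf b)
  stop    : ∀ ℓ → AllBefore b Gs (ρ̃ []) ℓ → RestrictsTo (lookup Gs ℓ) (ρ̃ []) (not b) →
            CDTView b G Gs ρ̃ (leaf (not b))
  recurse : ∀ ℓ {Γ Γ'} → AllBefore b Gs (ρ̃ []) ℓ →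
            ¬ RestrictsTo (lookup Gs ℓ) (ρ̃ []) b → ¬ RestrictsTo (lookup Gs ℓ) (ρ̃ []) (not b) →
            IsCDT (lookup Gs ℓ) (childRT ρ̃ (toℕ ℓ)) Γ → Graft (CDTAt G ρ̃) b [] (recTree b (ρ̃ []) Γ) Γ' →
            CDTView b G Gs ρ̃ Γ'

cdt-view : ∀ {b G Gs ρ̃ Γ} → IsGate {n} b G Gs → IsCDT G ρ̃ Γ → CDTView b G Gs ρ̃ Γ
cdt-view or-gate  (cdt-or-0 h)                 = all-b h
cdt-view or-gate  (cdt-or-1 ℓ pre h)           = stop ℓ pre h
cdt-view or-gate  (cdt-or-rec ℓ pre nb nnb ch gr)  = recurse ℓ pre nb nnb ch gr
cdt-view and-gate (cdt-and-1 h)                = all-b h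
cdt-view and-gate (cdt-and-0 ℓ pre h)          = stop ℓ pre h
cdt-view and-gate (cdt-and-rec ℓ pre nb nnb ch gr) = recurse ℓ pre nb nnb ch gr

AllBefore-unique : ∀ {b} {Gs : List (Formula n)} {σ ℓ ℓ'} → AllBefore b Gs σ ℓ → ¬ RestrictsTo (lookup Gs ℓ) σ b →
                   AllBefore b Gs σ ℓ' → ¬ RestrictsTo (lookup Gs ℓ') σ b → ℓ ≡ ℓ'
AllBefore-unique {ℓ = ℓ} {ℓ'} pre nb pre' nb' with <-cmp (toℕ ℓ) (toℕ ℓ')
... | tri< ℓ<ℓ' _ _ = ⊥-elim (nb (pre' ℓ ℓ<ℓ'))
... | tri≈ _ ℓ≡ℓ' _ = toℕ-injective ℓ≡ℓ'
... | tri> _ _ ℓ>ℓ' = ⊥-elim (nb' (pre ℓ' ℓ>ℓ'))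

AllBefore-≼ : ∀ {b} {Gs : List (Formula n)} {σ' σ ℓ} → σ' ≼ σ → AllBefore b Gs σ ℓ → AllBefore b Gs σ' ℓ
AllBefore-≼ {Gs = Gs} σ'≼σ pre i i<ℓ = RestrictsTo-≼ (lookup Gs i) σ'≼σ (pre i i<ℓ)

CDTView-all-b : ∀ {b G} {Gs : List (Formula n)} {ρ̃ Γ} → CDTView b G Gs ρ̃ Γ →
                (∀ i → RestrictsTo (lookup Gs i) (ρ̃ []) b) →
                Γ ≡ leaf b
CDTView-all-b (all-b _) _ = refl
CDTView-all-b {Gs = Gs} (stop ℓ _ h) all = ⊥-elim (RestrictsTo-unique {H = lookup Gs ℓ} (all ℓ) h)
CDTView-all-b (recurse ℓ _ nb _ _ _) all = ⊥-elim (nb (all ℓ))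

CDTView-recurse : ∀ {b G} {Gs : List (Formula n)} {ρ̃ Γ'} ℓ → CDTView b G Gs ρ̃ Γ' → AllBefore b Gs (ρ̃ []) ℓ →
                  ¬ RestrictsTo (lookup Gs ℓ) (ρ̃ []) b → ¬ RestrictsTo (lookup Gs ℓ) (ρ̃ []) (not b) →
                  ∃ λ Γ → IsCDT (lookup Gs ℓ) (childRT ρ̃ (toℕ ℓ)) Γ ×
                          Graft (CDTAt G ρ̃) b [] (recTree b (ρ̃ []) Γ) Γ'
CDTView-recurse ℓ (all-b all) _ nb _ = ⊥-elim (nb (all ℓ))
CDTView-recurse {Gs = Gs} ℓ (stop ℓ' pre' h) pre nb nnb =
  ⊥-elim (nnb (subst (λ k → RestrictsTo (lookup Gs k) _ _) (sym ℓ≡ℓ') h))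
  where
  ℓ≡ℓ' = AllBefore-unique {Gs = Gs} pre nb pre' (λ hb → RestrictsTo-unique {H = lookup Gs ℓ'} hb h)
CDTView-recurse {Gs = Gs} ℓ (recurse ℓ' pre' nb' _ ch gr) pre nb _
  with refl ← AllBefore-unique {Gs = Gs} pre nb pre' nb' = _ , ch , gr

readAlong : OrdRestr n → Walk n → OrdRestr n
readAlong α []                = α
readAlong α ((v , c , _) ∷ w) = readAlong (α ∷ʳ (v , c)) w

Graft-reaches : ∀ {R : OrdRestr n → DT n → Set} {b α t t' w₁} → Graft R b α t t' → Reaches t w₁ b →
                ∃ λ t₀ → R (readAlong α w₁) t₀ × (∀ {w₂ c} → Reaches t₀ w₂ c → Reaches t' (w₁ ++ w₂) c)
Graft-reaches (g-leafb r) end = _ , r , λ r₀ → r₀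
Graft-reaches (g-leafo b≢b) end = ⊥-elim (b≢b refl)
Graft-reaches (g-node (g-just g₀) g-nothing) (only0 ◂ q)
  with t₀ , r , extend ← Graft-reaches g₀ q = t₀ , r , λ q₀ → only0 ◂ extend q₀
Graft-reaches (g-node g-nothing (g-just g₁)) (only1 ◂ q)
  with t₀ , r , extend ← Graft-reaches g₁ q = t₀ , r , λ q₀ → only1 ◂ extend q₀
Graft-reaches (g-node (g-just g₀) (g-just _)) (fork0 ◂ q)
  with t₀ , r , extend ← Graft-reaches g₀ q = t₀ , r , λ q₀ → fork0 ◂ extend q₀
Graft-reaches (g-node (g-just _) (g-just g₁)) (fork1 ◂ q)
  with t₀ , r , extend ← Graft-reaches g₁ q = t₀ , r , λ q₀ → fork1 ◂ extend q₀

Represents-all-b : ∀ b {F : Formula n} {σ C} → Represents F σ C → allLeaves b C ≡ true → RestrictsTo F σ b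
Represents-all-b b {F} rep all = RestrictsTo-intro F λ x x⊨σ →
  let _ , r , _ = ⇓⇒Reaches (computes rep x⊨σ) in allLeaves-reaches b r all

child-Represents : ∀ {b b' G Gs ρ̃ Γ} → IsGate {n} b' G Gs → IsRestrTree G ρ̃ → ∀ ℓ →
                   IsCDT (lookup Gs ℓ) (childRT ρ̃ (toℕ ℓ)) Γ →
                   Represents (lookup Gs ℓ) (ρ̃ []) (contract b (applyR (ρ̃ []) Γ))
child-Represents {b = b} g rt ℓ ch =
  contract-applyR-Represents b (IsRestrTree-root g rt ℓ) (cdt-Represents (IsRestrTree-child g rt ℓ) ch)

recTree-balanceRec : ∀ b σ (Γ : DT n) {w c} → Reaches (recTree b σ Γ) w c →
                     Reaches (balanceRec b (contract b (applyR σ Γ))) w c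
recTree-balanceRec b σ Γ = subst (λ t → Reaches t _ _) (balance≡balanceRec∘contract b (applyR σ Γ))

recTree-balanceRec⁻ : ∀ b σ (Γ : DT n) {w c} → Reaches (balanceRec b (contract b (applyR σ Γ))) w c →
                      Reaches (recTree b σ Γ) w c
recTree-balanceRec⁻ b σ Γ = subst (λ t → Reaches t _ _) (sym (balance≡balanceRec∘contract b (applyR σ Γ)))

-- Stability of walks

module Stability {n : ℕ} (A : Fin n → Set) where

  Agree : Restriction n → Restriction n → Set
  Agree σ' σ = ∀ v → A v → σ' v ≡ σ v

  -- The b-walk through A of the balanced tree yields inputs extending σ' with
  -- either value of F, so F stays non-constant under σ'.
  branch-persists : ∀ b {F : Formula n} {σ σ' C w} → Represents F σ C → Contracted b C → σ' ≼ σ → Agree σ' σ →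
                    ¬ RestrictsTo F σ b → Reaches (balanceRec b C) w b → AllVars A w →
                    ¬ RestrictsTo F σ' b × ¬ RestrictsTo F σ' (not b)
  branch-persists b {F} {σ' = σ'} {C} rep contracted σ'≼σ agree nb r as = F|σ'≢b , F|σ'≢¬b
    where
    consistent : ∀ {w' d} → AllVars A w' → Reaches C w' d → ConsistentWalk σ' w'
    consistent as' r' = ConsistentWalk-agree agree as' (Fits-consistent (fits rep) r')

    not-all-b : allLeaves b C ≡ false
    not-all-b with allLeaves b C in all
    ... | false = refl
    ... | true  = ⊥-elim (nb (Represents-all-b b rep all))

    F|σ'≢b : ¬ RestrictsTo F σ' b
    F|σ'≢b with _ , _ , r' , d≢b , vars ← balanceRec-non-b b C contracted not-all-b r =
      Represents-¬RestrictsTo rep σ'≼σ (consistent (AllVars-map vars as) r') r' d≢b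

    F|σ'≢¬b : ¬ RestrictsTo F σ' (not b)
    F|σ'≢¬b with w₁ , _ , refl , r₁ ← balanceRec-b-prefix b C r =
      Represents-¬RestrictsTo rep σ'≼σ (consistent (All.++⁻ˡ w₁ as) r₁) r₁ (not-¬ refl)

  contract-applyR-Refines : ∀ b {F : Formula n} {σ σ' Γ₁ Γ₂} → σ' ≼ σ → Agree σ' σ →
    Represents F σ (contract b (applyR σ Γ₁)) → Represents F σ' (contract b (applyR σ' Γ₂)) →
    (∀ {w} → Reaches Γ₁ w (not b) → AllVars A w → Reaches Γ₂ w (not b)) →
    Refines A b (contract b (applyR σ Γ₁)) (contract b (applyR σ' Γ₂))
  contract-applyR-Refines b {σ = σ} {σ'} {Γ₁} {Γ₂} σ'≼σ agree rep₁ rep₂ stable = record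
    { keeps-non-b = keeps-non-b
    ; keeps-b     = λ r₁ _ r₂ → Represents-keeps-b rep₁ rep₂ σ'≼σ r₁ r₂
    }
    where
    keeps-non-b : ∀ {w d} → Reaches (contract b (applyR σ Γ₁)) w d → d ≢ b → AllVars A w →
                  Reaches (contract b (applyR σ' Γ₂)) w d
    keeps-non-b r d≢b as with refl ← ¬-not d≢b
      with w° , r° , ps ← applyR-reaches⁻ σ Γ₁ (contract-reaches⁻ b _ r d≢b) =
      contract-reaches b (applyR-reaches σ' (stable r° (Pruned-AllVars ps as)) (Pruned-agree agree as ps)) d≢b

  record Compatible (G : Formula n) (ρ̃ ρ̃' : RTree n) : Set where
    field
      wf     : WF G
      rt     : IsRestrTree G ρ̃
      rt'    : IsRestrTree G ρ̃'
      below  : ρ̃' ≼T ρ̃ within G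
      agrees : ∀ p → ValidPos G p → Agree (ρ̃' p) (ρ̃ p)
  open Compatible

  Compatible-restrictF : ∀ {G ρ̃ ρ̃'} (σ : Restriction n) → Compatible G ρ̃ ρ̃' → Compatible (restrictF G σ) ρ̃ ρ̃'
  Compatible-restrictF {G} σ c = record
    { wf = WF-restrictF (wf c) ; rt = IsRestrTree-restrictF G (rt c) ; rt' = IsRestrTree-restrictF G (rt' c)
    ; below = λ p → below c p ∘ ValidPos-restrictF G ; agrees = λ p → agrees c p ∘ ValidPos-restrictF G }

  Compatible-child : ∀ {b G Gs ρ̃ ρ̃'} → IsGate b G Gs → Compatible G ρ̃ ρ̃' → ∀ ℓ →
                     Compatible (lookup Gs ℓ) (childRT ρ̃ (toℕ ℓ)) (childRT ρ̃' (toℕ ℓ))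
  Compatible-child g c ℓ = record
    { wf = proj₂ (WF-child g (wf c) ℓ) ; rt = IsRestrTree-child g (rt c) ℓ ; rt' = IsRestrTree-child g (rt' c) ℓ
    ; below = λ p → below c _ ∘ ValidPos-child g ℓ ; agrees = λ p → agrees c _ ∘ ValidPos-child g ℓ }

  -- A b-walk of a grafted tree, cut where it enters a grafted CDT; continue is the
  -- induction hypothesis for that CDT, compared with its counterpart under ρ̃'.
  record Split (b : Bool) (G : Formula n) (ρ̃' : RTree n) (α : OrdRestr n) (t : DT n) (w : Walk n) : Set where
    field
      w₁ w₂    : Walk n
      w≡       : w ≡ w₁ ++ w₂
      reaches₁ : Reaches t w₁ b
      inA₁     : AllVars A w₁
      continue : ∀ {Γ} → IsCDT (restrictF G (toRestr (readAlong α w₁))) ρ̃' Γ → Reaches Γ w₂ b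

  Split-∷ : ∀ {b G ρ̃' α t t' w x c g} → A x → Split b G ρ̃' (α ∷ʳ (x , c)) t w →
            (∀ {w'} → Reaches t w' b → Reaches t' ((x , c , g) ∷ w') b) → Split b G ρ̃' α t' ((x , c , g) ∷ w)
  Split-∷ a sp extend = record
    { w₁ = _ ∷ Split.w₁ sp ; w₂ = Split.w₂ sp ; w≡ = cong (_ ∷_) (Split.w≡ sp)
    ; reaches₁ = extend (Split.reaches₁ sp) ; inA₁ = a ∷ Split.inA₁ sp ; continue = Split.continue sp }

  all-b-stable : ∀ {b G Gs ρ̃ ρ̃' Γ'} → IsGate b G Gs → Compatible G ρ̃ ρ̃' →
                 (∀ i → RestrictsTo (lookup Gs i) (ρ̃ []) b) → IsCDT G ρ̃' Γ' → Reaches Γ' [] b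
  all-b-stable {Gs = Gs} g c all D'
    with refl ← CDTView-all-b (cdt-view g D') (λ i → RestrictsTo-≼ (lookup Gs i) (below c [] here) (all i)) = end

  mutual
    stable : ∀ {b G Gs ρ̃ ρ̃' Γ Γ' w} → IsGate b G Gs → Compatible G ρ̃ ρ̃' → IsCDT G ρ̃ Γ → IsCDT G ρ̃' Γ' →
             Reaches Γ w b → AllVars A w → Reaches Γ' w b
    stable or-gate  c (cdt-or-0 all)  D' end [] = all-b-stable or-gate c all D'
    stable and-gate c (cdt-and-1 all) D' end [] = all-b-stable and-gate c all D'
    stable or-gate  c (cdt-or-1 _ _ _)  D' (() ◂ _) _
    stable and-gate c (cdt-and-0 _ _ _) D' (() ◂ _) _
    stable or-gate  c (cdt-or-rec ℓ pre nb nnb ch gr)  D' r as = recursive-stable or-gate c ℓ pre nb nnb ch gr D' r as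
    stable and-gate c (cdt-and-rec ℓ pre nb nnb ch gr) D' r as = recursive-stable and-gate c ℓ pre nb nnb ch gr D' r as

    graft-split : ∀ {b G Gs ρ̃ ρ̃' α t Γ w} → IsGate b G Gs → Compatible G ρ̃ ρ̃' → Graft (CDTAt G ρ̃) b α t Γ →
                  Reaches Γ w b → AllVars A w → Split b G ρ̃' α t w
    graft-split g c (g-leafb r) q as = record
      { w₁ = [] ; w₂ = _ ; w≡ = refl ; reaches₁ = end ; inA₁ = []
      ; continue = λ D' → stable (restrictF-IsGate _ g) (Compatible-restrictF _ c) r D' q as }
    graft-split g c (g-leafo b≢b) end _ = ⊥-elim (b≢b refl)
    graft-split g c (g-node (g-just g₀) g-nothing) (only0 ◂ q) (a ∷ as) = Split-∷ a (graft-split g c g₀ q as) (only0 ◂_)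
    graft-split g c (g-node g-nothing (g-just g₁)) (only1 ◂ q) (a ∷ as) = Split-∷ a (graft-split g c g₁ q as) (only1 ◂_)
    graft-split g c (g-node (g-just g₀) (g-just _)) (fork0 ◂ q) (a ∷ as) = Split-∷ a (graft-split g c g₀ q as) (fork0 ◂_)
    graft-split g c (g-node (g-just _) (g-just g₁)) (fork1 ◂ q) (a ∷ as) = Split-∷ a (graft-split g c g₁ q as) (fork1 ◂_)

    recursive-stable : ∀ {b G Gs ρ̃ ρ̃' Γ₁ Γ Γ' w} → IsGate b G Gs → Compatible G ρ̃ ρ̃' → ∀ ℓ →
      AllBefore b Gs (ρ̃ []) ℓ → ¬ RestrictsTo (lookup Gs ℓ) (ρ̃ []) b → ¬ RestrictsTo (lookup Gs ℓ) (ρ̃ []) (not b) →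
      IsCDT (lookup Gs ℓ) (childRT ρ̃ (toℕ ℓ)) Γ₁ → Graft (CDTAt G ρ̃) b [] (recTree b (ρ̃ []) Γ₁) Γ →
      IsCDT G ρ̃' Γ' → Reaches Γ w b → AllVars A w → Reaches Γ' w b
    recursive-stable {b} {Gs = Gs} {ρ̃} {ρ̃'} {Γ₁} g c ℓ pre nb nnb ch gr D' r as
      with record { w₁ = w₁ ; w≡ = refl ; reaches₁ = r₁ ; inA₁ = as₁ ; continue = continue } ← graft-split g c gr r as
      with F|σ'≢b , F|σ'≢¬b ← branch-persists b (child-Represents g (rt c) ℓ ch)
                                              (contract-Contracted b (applyR (ρ̃ []) Γ₁))
                                              (below c [] here) (agrees c [] here) nb (recTree-balanceRec b (ρ̃ []) Γ₁ r₁) as₁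
      with Γ₂ , ch' , gr' ← CDTView-recurse ℓ (cdt-view g D') (AllBefore-≼ {Gs = Gs} (below c [] here) pre) F|σ'≢b F|σ'≢¬b
      with t₀ , r₀ , extend ← Graft-reaches gr'
             (recTree-balanceRec⁻ b (ρ̃' []) Γ₂
               (balanceRec-Refines A b _ _ (contract-Contracted b (applyR (ρ̃ []) Γ₁))
                                           (contract-Contracted b (applyR (ρ̃' []) Γ₂))
                 (child-Refines g c ℓ ch ch') (recTree-balanceRec b (ρ̃ []) Γ₁ r₁) as₁))
      = extend (continue r₀)

    child-Refines : ∀ {b G Gs ρ̃ ρ̃' Γ₁ Γ₂} → IsGate b G Gs → Compatible G ρ̃ ρ̃' → ∀ ℓ →
                    IsCDT (lookup Gs ℓ) (childRT ρ̃ (toℕ ℓ)) Γ₁ → IsCDT (lookup Gs ℓ) (childRT ρ̃' (toℕ ℓ)) Γ₂ →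
                    Refines A b (contract b (applyR (ρ̃ []) Γ₁)) (contract b (applyR (ρ̃' []) Γ₂))
    child-Refines {b} g c ℓ ch ch' =
      contract-applyR-Refines b (below c [] here) (agrees c [] here)
        (child-Represents g (rt c) ℓ ch) (child-Represents g (rt' c) ℓ ch')
        (child-stable (proj₁ (WF-child g (wf c) ℓ)) (Compatible-child g c ℓ) ch ch')

    child-stable : ∀ {b F ρ̃ ρ̃' Γ Γ' w} → NotGate b F → Compatible F ρ̃ ρ̃' → IsCDT F ρ̃ Γ → IsCDT F ρ̃' Γ' →
                   Reaches Γ w (not b) → AllVars A w → Reaches Γ' w (not b)
    child-stable _ _ (cdt-const _) (cdt-const _) r _ = r
    child-stable _ c (cdt-lit-fixed e) (cdt-lit-fixed e') r _ with refl ← proj₂ (below c [] here) _ _ _ e' e = r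
    child-stable _ c (cdt-lit-fixed e) (cdt-lit-free e') _ _ with () ← trans (sym e) (proj₁ (below c [] here) _ e')
    child-stable _ c (cdt-lit-free e) (cdt-lit-fixed e') (fork0 ◂ _) (a ∷ _)
      with () ← trans (sym e') (trans (agrees c [] here _ a) e)
    child-stable _ c (cdt-lit-free e) (cdt-lit-fixed e') (fork1 ◂ _) (a ∷ _)
      with () ← trans (sym e') (trans (agrees c [] here _ a) e)
    child-stable _ _ (cdt-lit-free _) (cdt-lit-free _) r _ = r
    child-stable {true}  {or _}  _ c D D' r as = stable or-gate c D D' r as
    child-stable {false} {and _} _ c D D' r as = stable and-gate c D D' r as

walkRestr-AllVars : ∀ (w : Walk n) → AllVars (_∈Dom walkRestr w) w
walkRestr-AllVars []      = []
walkRestr-AllVars (_ ∷ w) = here refl ∷ All.map there (walkRestr-AllVars w)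

lemma4p2 : ∀ {n : ℕ} (b : Bool) (Fs : List (Formula n)) → WF (gate b Fs) →
           (ρ̃ : RTree n) → IsRestrTree (gate b Fs) ρ̃ →
           (s : ℕ) → 1 ≤ s → (a : Vec Bool s) → (α : OrdRestr n) →
           (Γ : DT n) → IsCDT (gate b Fs) ρ̃ Γ → CDTpath b (toList a) Γ ≡ just α →
           (ρ̃' : RTree n) → IsRestrTree (gate b Fs) ρ̃' →
           ρ̃' ≼T ρ̃ within (gate b Fs) →
           (∀ p → ValidPos (gate b Fs) p → ∀ v → v ∈Dom α → ρ̃' p v ≡ ρ̃ p v) →
           (Γ' : DT n) → IsCDT (gate b Fs) ρ̃' Γ' → CDTpath b (toList a) Γ' ≡ just α
lemma4p2 b Fs wf ρ̃ rt _ _ a _ Γ cdt path ρ̃' rt' below agrees _ cdt'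
  with w , reaches , labels , refl ← walk-sound b Γ (toList a) [] path rewrite sym labels =
  walk-complete b [] (stable (gate-IsGate b Fs) compatible cdt cdt' reaches (walkRestr-AllVars w))
  where
  open Stability (_∈Dom walkRestr w)
  compatible : Compatible (gate b Fs) ρ̃ ρ̃'
  compatible = record { wf = wf ; rt = rt ; rt' = rt' ; below = below ; agrees = agrees }
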